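{- Let $r\ge2$, $k\ge1$, $p\ge1$ and $m\ge1$ be integers. Assume $F$ is a $k$-rowed $p$-simple $(0,1)$-matrix such that $p\cdot K_k^s\prec F$ for some $0\le s\le k$. If $(r-2)^{m-k}\ge p-1$, then \[\operatorname{forb}(m,r,F)=\sum_{n=0}^{k-1}\binom{m}{n}(r-1)^{m-n}+(p-1)\binom{m}{k}.\] If $F$ is a simple $k$-rowed $(0,1)$-matrix and $K_k^s\prec F$ for some $0\le s\le k$, then $\operatorname{forb}(m,r,F)=\operatorname{forb}(m,r,K_k^s)=\operatorname{forb}(m,r,K_k)$ for all $m\in\mathbb N$ and $r\ge2$.
   Context: An $r$-matrix is a matrix with entries in $\{0,1,\dots,r-1\}$. A matrix is simple if it has no repeated columns, and $p$-simple if every column has multiplicity at most $p$. $F\prec A$ means $A$ contains a submatrix that is a row and column permutation of $F$; otherwise $A$ avoids $F$. $\operatorname{forb}(m,r,F)$ is the maximum number of columns of a simple $m$-rowed $r$-matrix that avoids $F$. $K_k$ is the $k\times2^k$ matrix of all $(0,1)$-columns of length $k$; $K_k^s$ is the $k\times\binom ks$ matrix of all $(0,1)$-columns of length $k$ with exactly $s$ ones. $p\cdot F$ denotes $p$ copies of $F$ placed side by side. -}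

module Defs where

open import Data.Nat using (ℕ; zero; suc; _+_; _*_; _∸_; _^_; _≤_; _<_)
open import Data.Nat.Properties using (_≟_)
open import Data.Fin using (Fin)
open import Data.Fin.Properties using (all?)
open import Data.List using (List; []; _∷_; map; _++_; length; filter; allFin; concat; replicate; sum)
import Data.List as L
open import Data.Vec using (Vec; []; _∷_; lookup)
import Data.Vec as V
open import Data.Product using (Σ; _×_; _,_)
open import Function.Definitions using (Injective)
open import Relation.Binary.PropositionalEquality using (_≡_)
open import Relation.Nullary using (¬_; Dec)

Mat : ℕ → ℕ → Set
Mat m n = Fin m → Fin n → ℕ

IsRMatrix : ∀ {m n} → ℕ → Mat m n → Set
IsRMatrix r A = ∀ i j → A i j < r

ColEq : ∀ {m n} → Mat m n → Fin n → Fin n → Set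
ColEq A j j' = ∀ i → A i j ≡ A i j'

ColEq? : ∀ {m n} (A : Mat m n) (j j' : Fin n) → Dec (ColEq A j j')
ColEq? A j j' = all? (λ i → A i j ≟ A i j')

multiplicity : ∀ {m n} → Mat m n → Fin n → ℕ
multiplicity A j = length (filter (ColEq? A j) (allFin _))

Simple : ∀ {m n} → Mat m n → Set
Simple A = ∀ j j' → ColEq A j j' → j ≡ j'

PSimple : ∀ {m n} → ℕ → Mat m n → Set
PSimple p A = ∀ j → multiplicity A j ≤ p

-- F ≺ A : A has a submatrix which is a row and column permutation of F,
-- i.e. there are injective row and column selections σ, τ with A (σ i) (τ j) = F i j.
_≺_ : ∀ {k l m n} → Mat k l → Mat m n → Set
_≺_ {k} {l} {m} {n} F A =
  Σ (Fin k → Fin m) λ σ → Σ (Fin l → Fin n) λ τ →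
    Injective _≡_ _≡_ σ × Injective _≡_ _≡_ τ × (∀ i j → A (σ i) (τ j) ≡ F i j)

Avoids : ∀ {k l m n} → Mat m n → Mat k l → Set
Avoids A F = ¬ (F ≺ A)

IsForb : ∀ {k l} → ℕ → ℕ → Mat k l → ℕ → Set
IsForb m r F N =
  (Σ (Mat m N) λ A → IsRMatrix r A × Simple A × Avoids A F)
  × (∀ n (A : Mat m n) → IsRMatrix r A → Simple A → Avoids A F → n ≤ N)

fromCols : ∀ {k} (cs : List (Vec ℕ k)) → Mat k (length cs)
fromCols cs i j = lookup (L.lookup cs j) i

allCols : (k : ℕ) → List (Vec ℕ k)
allCols zero = [] ∷ []
allCols (suc k) = map (0 ∷_) (allCols k) ++ map (1 ∷_) (allCols k)

ones : ∀ {k} → Vec ℕ k → ℕ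
ones v = V.sum v

colsWith : (k s : ℕ) → List (Vec ℕ k)
colsWith k s = filter (λ v → ones v ≟ s) (allCols k)

K : (k : ℕ) → Mat k (length (allCols k))
K k = fromCols (allCols k)

Ks : (k s : ℕ) → Mat k (length (colsWith k s))
Ks k s = fromCols (colsWith k s)

pKs : (p k s : ℕ) → Mat k (length (concat (replicate p (colsWith k s))))
pKs p k s = fromCols (concat (replicate p (colsWith k s)))

module Submission where

-- Write G m k for the sum Σ_{n<k} C(m,n)(r-1)^{m-n}; it satisfies the Pascal-type
-- recurrence G(m+1,k+1) = G(m,k) + (r-1)·G(m,k+1).  A simple m-rowed r-matrix
-- is recorded by its column indicator, a function on the r^m possible columns.
--
-- Upper bound (UpperBound): standard induction on the first row splits the
-- indicator into a low part (paired columns starting with 0 and 1) and a high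
-- part.  Unless the total is at most G m k + (p-1)·C(m,k), some branch yields k
-- rows on which every (0,1)-pattern is shown p times, and a matching argument
-- (Occurrences) then embeds any p-simple (0,1)-matrix F.
--
-- Lower bound (ColumnWords, WordPatterns, LowerBound): with a = k - s, b = s,
-- take the G m k columns whose (0,1)-entries avoid the word 0^a 1^b and, for
-- each of the C(m,k) position sets, p-1 columns carrying exactly 0^a 1^b there.
-- Along any k rows the word's own pattern, which has s ones, is shown by no
-- avoider and by at most p-1 carriers, so p·K_k^s and hence F is avoided.

open import Defs
open import Data.Nat using (ℕ; zero; suc; _+_; _*_; _∸_; _^_; _≤_; _<_; _≤?_; _⊓_; _⊔_; z≤n; s≤s; pred)
open import Data.Nat.Properties hiding (suc-injective)
open import Data.Nat.Combinatorics using (_C_; nCk+nC[k+1]≡[n+1]C[k+1]; k>n⇒nCk≡0)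
open import Data.Nat.ListAction using (sum)
open import Data.Nat.ListAction.Properties using (sum-++)
open import Data.Nat.Tactic.RingSolver using (solve-∀)
open import Data.Fin using (Fin; zero; suc; toℕ; punchIn; punchOut)
open import Data.Fin.Properties using (all?; any?; suc-injective; punchIn-injective; punchInᵢ≢i; punchOut-injective; punchIn-punchOut; injective⇒≤; ¬Fin0) renaming (_≟_ to _≟ᶠ_)
open import Data.Vec using (Vec; []; _∷_; lookup; tabulate)
open import Data.Vec.Properties using (lookup∘tabulate; tabulate∘lookup; tabulate-cong; ≡-dec)
import Data.List as L
open import Data.List.Properties using (map-++; map-∘; map-cong)
open import Data.List using (List; []; _∷_; _++_; map; filter; length; upTo; applyUpTo; concat; replicate)
open import Data.List.Relation.Unary.All as All using (All; []; _∷_)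
import Data.List.Relation.Unary.All.Properties as Allₚ
open import Data.List.Membership.Propositional.Properties using (∈-lookup)
open import Function using (_∘_; id)
open import Function.Definitions using (Injective)
open import Relation.Binary.PropositionalEquality
open import Relation.Nullary using (¬_; Dec; yes; no)
open import Relation.Nullary.Decidable using (_⊎-dec_)
open import Data.Product using (Σ; _×_; _,_; proj₁; proj₂)
open import Data.Sum using (_⊎_; inj₁; inj₂)
open import Data.Empty using (⊥; ⊥-elim)
open import Data.Unit using (⊤; tt)
open import Data.Vec.Functional using (insertAt)
open import Data.Vec.Functional.Properties using (insertAt-lookup; insertAt-punchIn)

when : ∀ {a} {P : Set a} → Dec P → ℕ → ℕ
when (yes _) y = y
when (no _) _ = 0

when-yes : ∀ {a} {P : Set a} (d : Dec P) y → P → when d y ≡ y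
when-yes (yes _) y _ = refl
when-yes (no ¬p) y p = ⊥-elim (¬p p)

when-no : ∀ {a} {P : Set a} (d : Dec P) y → ¬ P → when d y ≡ 0
when-no (yes p) y ¬p = ⊥-elim (¬p p)
when-no (no _) y _ = refl

when-≤ : ∀ {a} {P : Set a} (d : Dec P) y → when d y ≤ y
when-≤ (yes _) y = ≤-refl
when-≤ (no _) y = z≤n

when-mono : ∀ {a b} {P : Set a} {Q : Set b} (d : Dec P) (e : Dec Q) {y z}
          → (P → Q) → y ≤ z → when d y ≤ when e z
when-mono (yes p) (yes q) f h = h
when-mono (yes p) (no ¬q) f h = ⊥-elim (¬q (f p))
when-mono (no _) e f h = z≤n

when-cong : ∀ {a b} {P : Set a} {Q : Set b} (d : Dec P) (e : Dec Q) y
          → (P → Q) → (Q → P) → when d y ≡ when e y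
when-cong d e y f g = ≤-antisym (when-mono d e f ≤-refl) (when-mono e d g ≤-refl)

when-pos : ∀ {a} {P : Set a} (d : Dec P) y → 1 ≤ when d y → P
when-pos (yes p) y _ = p
when-pos (no _) y ()

when-comm : ∀ {a b} {P : Set a} {Q : Set b} (d : Dec P) (e : Dec Q) y
          → when d (when e y) ≡ when e (when d y)
when-comm (yes _) (yes _) y = refl
when-comm (yes _) (no _) y = refl
when-comm (no _) (yes _) y = refl
when-comm (no _) (no _) y = refl

when-× : ∀ {a b c} {A : Set a} {B : Set b} {C : Set c} (d : Dec A) (e : Dec B) (f : Dec C)
       → (A → B × C) → (B → C → A) → when d 1 ≡ when e (when f 1)
when-× (yes _) (yes _) (yes _) split join = refl
when-× (yes a) (yes _) (no ¬c) split join = ⊥-elim (¬c (proj₂ (split a)))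
when-× (yes a) (no ¬b) _ split join = ⊥-elim (¬b (proj₁ (split a)))
when-× (no ¬a) (yes b) (yes c) split join = ⊥-elim (¬a (join b c))
when-× (no _) (yes _) (no _) split join = refl
when-× (no _) (no _) _ split join = refl

∑ : (n : ℕ) → (Fin n → ℕ) → ℕ
∑ zero f = 0
∑ (suc n) f = f zero + ∑ n (f ∘ suc)

∑-cong : ∀ n {f g : Fin n → ℕ} → (∀ a → f a ≡ g a) → ∑ n f ≡ ∑ n g
∑-cong zero e = refl
∑-cong (suc n) e = cong₂ _+_ (e zero) (∑-cong n (e ∘ suc))

∑-mono : ∀ n {f g : Fin n → ℕ} → (∀ a → f a ≤ g a) → ∑ n f ≤ ∑ n g
∑-mono zero h = z≤n
∑-mono (suc n) h = +-mono-≤ (h zero) (∑-mono n (h ∘ suc))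

∑-+ : ∀ n (f g : Fin n → ℕ) → ∑ n (λ a → f a + g a) ≡ ∑ n f + ∑ n g
∑-+ zero f g = refl
∑-+ (suc n) f g = begin
    f zero + g zero + ∑ n (λ a → f (suc a) + g (suc a))
  ≡⟨ cong (f zero + g zero +_) (∑-+ n (f ∘ suc) (g ∘ suc)) ⟩
    f zero + g zero + (∑ n (f ∘ suc) + ∑ n (g ∘ suc))
  ≡⟨ interchange (f zero) (g zero) _ _ ⟩
    f zero + ∑ n (f ∘ suc) + (g zero + ∑ n (g ∘ suc)) ∎
  where
  open ≡-Reasoning
  interchange : ∀ a b c d → a + b + (c + d) ≡ a + c + (b + d)
  interchange = solve-∀

∑-zero : ∀ n (f : Fin n → ℕ) → (∀ a → f a ≡ 0) → ∑ n f ≡ 0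
∑-zero n f h = trans (∑-cong n h) (∑-0 n)
  where
  ∑-0 : ∀ n → ∑ n (λ _ → 0) ≡ 0
  ∑-0 zero = refl
  ∑-0 (suc n) = ∑-0 n

∑-count : ∀ n → ∑ n (λ _ → 1) ≡ n
∑-count zero = refl
∑-count (suc n) = cong suc (∑-count n)

∑-when : ∀ {a} {P : Set a} (d : Dec P) n (f : Fin n → ℕ) → ∑ n (λ v → when d (f v)) ≡ when d (∑ n f)
∑-when (yes _) n f = refl
∑-when (no _) n f = ∑-zero n _ (λ _ → refl)

∑-punch : ∀ n (f : Fin (suc n) → ℕ) (a : Fin (suc n)) → ∑ (suc n) f ≡ f a + ∑ n (f ∘ punchIn a)
∑-punch n f zero = refl
∑-punch (suc n) f (suc a) = begin
    f zero + ∑ (suc n) (f ∘ suc)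
  ≡⟨ cong (f zero +_) (∑-punch n (f ∘ suc) a) ⟩
    f zero + (f (suc a) + ∑ n (f ∘ suc ∘ punchIn a))
  ≡⟨ +-swap (f zero) (f (suc a)) _ ⟩
    f (suc a) + (f zero + ∑ n (f ∘ suc ∘ punchIn a)) ∎
  where
  open ≡-Reasoning
  +-swap : ∀ a b c → a + (b + c) ≡ b + (a + c)
  +-swap = solve-∀

∑-term : ∀ n (f : Fin n → ℕ) a → f a ≤ ∑ n f
∑-term (suc n) f a = subst (f a ≤_) (sym (∑-punch n f a)) (m≤m+n _ _)

∑-positive : ∀ n (f : Fin n → ℕ) → 1 ≤ ∑ n f → Σ (Fin n) λ a → 1 ≤ f a
∑-positive (suc n) f h with f zero in eq
... | suc _ = zero , subst (1 ≤_) (sym eq) (s≤s z≤n)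
... | zero = let (a , q) = ∑-positive n (f ∘ suc) h in suc a , q

∑-injection : ∀ l n (τ : Fin l → Fin n) → Injective _≡_ _≡_ τ → (f : Fin l → ℕ) (g : Fin n → ℕ)
            → (∀ j → f j ≤ g (τ j)) → ∑ l f ≤ ∑ n g
∑-injection zero n τ inj f g h = z≤n
∑-injection (suc l) zero τ inj f g h with τ zero
... | ()
∑-injection (suc l) (suc n) τ inj f g h =
  subst (∑ (suc l) f ≤_) (sym (∑-punch n g a))
    (+-mono-≤ (h zero) (∑-injection l n τ′ τ′-injective (f ∘ suc) (g ∘ punchIn a) h′))
  where
  a = τ zero
  a≢τsuc : ∀ j → a ≢ τ (suc j)
  a≢τsuc j e with inj e
  ... | ()
  τ′ : Fin l → Fin n
  τ′ j = punchOut (a≢τsuc j)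
  τ′-injective : Injective _≡_ _≡_ τ′
  τ′-injective {i} {j} e = suc-injective (inj (punchOut-injective (a≢τsuc i) (a≢τsuc j) e))
  h′ : ∀ j → f (suc j) ≤ g (punchIn a (τ′ j))
  h′ j = subst (λ z → f (suc j) ≤ g z) (sym (punchIn-punchOut (a≢τsuc j))) (h (suc j))

∑-≤1 : ∀ n (f : Fin n → ℕ) → (∀ a → f a ≤ 1) → (∀ a b → 1 ≤ f a → 1 ≤ f b → a ≡ b) → ∑ n f ≤ 1
∑-≤1 zero f h u = z≤n
∑-≤1 (suc n) f h u with f zero in eq
... | zero = ∑-≤1 n (f ∘ suc) (h ∘ suc) (λ a b p q → suc-injective (u (suc a) (suc b) p q))
... | suc c = subst (_≤ 1) (cong (suc c +_) (sym (∑-zero n (f ∘ suc) rest-zero)))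
                (subst (λ z → z + 0 ≤ 1) eq (subst (_≤ 1) (sym (+-identityʳ (f zero))) (h zero)))
  where
  rest-zero : ∀ a → f (suc a) ≡ 0
  rest-zero a with f (suc a) in e
  ... | zero = refl
  ... | suc _ with u zero (suc a) (subst (1 ≤_) (sym eq) (s≤s z≤n)) (subst (1 ≤_) (sym e) (s≤s z≤n))
  ... | ()

∑≤1-unique : ∀ n (f : Fin n → ℕ) → ∑ n f ≤ 1 → ∀ a a′ → 1 ≤ f a → 1 ≤ f a′ → a ≡ a′
∑≤1-unique (suc n) f le a a′ pa pa′ with a ≟ᶠ a′
... | yes e = e
... | no a≢a′ = ⊥-elim (2≰1 (≤-trans two≤ le))
  where
  2≰1 : ¬ (2 ≤ 1)
  2≰1 (s≤s ())
  pa″ : 1 ≤ f (punchIn a (punchOut a≢a′))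
  pa″ = subst (λ z → 1 ≤ f z) (sym (punchIn-punchOut a≢a′)) pa′
  two≤ : 2 ≤ ∑ (suc n) f
  two≤ = subst (2 ≤_) (sym (∑-punch n f a))
           (+-mono-≤ pa (≤-trans pa″ (∑-term n (f ∘ punchIn a) (punchOut a≢a′))))

∑< : ℕ → (ℕ → ℕ) → ℕ
∑< n f = ∑ n (λ i → f (toℕ i))

∑<-term : ∀ n (f : ℕ → ℕ) v → v < n → f v ≤ ∑< n f
∑<-term (suc n) f zero _ = m≤m+n (f 0) _
∑<-term (suc n) f (suc v) (s≤s v<n) = ≤-trans (∑<-term n (f ∘ suc) v v<n) (m≤n+m _ (f 0))

∑<-single : ∀ n (f : ℕ → ℕ) v → v < n → (∀ u → u ≢ v → f u ≡ 0) → ∑< n f ≡ f v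
∑<-single (suc n) f zero _ h =
  trans (cong (f 0 +_) (∑-zero n _ (λ u → h (suc (toℕ u)) (λ ())))) (+-identityʳ _)
∑<-single (suc n) f (suc v) (s≤s v<n) h rewrite h 0 (λ ()) =
  ∑<-single n (f ∘ suc) v v<n (λ u u≢v → h (suc u) (u≢v ∘ cong pred))

∑<-bound : ∀ n (f : ℕ → ℕ) q → (∀ v → f v ≤ q) → ∑< n f ≤ n * q
∑<-bound zero f q h = z≤n
∑<-bound (suc n) f q h = +-mono-≤ (h 0) (∑<-bound n (f ∘ suc) q (h ∘ suc))

∑<-const : ∀ n c → ∑< n (λ _ → c) ≡ n * c
∑<-const zero c = refl
∑<-const (suc n) c = cong (c +_) (∑<-const n c)

∑<-* : ∀ n c (f : ℕ → ℕ) → ∑< n (λ w → c * f w) ≡ c * ∑< n f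
∑<-* zero c f = sym (*-zeroʳ c)
∑<-* (suc n) c f = trans (cong (c * f 0 +_) (∑<-* n c (f ∘ suc))) (sym (*-distribˡ-+ c (f 0) _))

∑<-blocks : ∀ n Q R → ∑< n (λ w → (Q ∸ w * R) ⊓ R) ≡ Q ⊓ (n * R)
∑<-blocks zero Q R = sym (⊓-zeroʳ Q)
∑<-blocks (suc n) Q R =
  trans (cong (Q ⊓ R +_) (trans (∑-cong n (λ w → cong (_⊓ R) (sym (∸-+-assoc Q R (toℕ w * R)))))
                                (∑<-blocks n (Q ∸ R) R)))
        (first-block Q R (n * R))
  where
  first-block : ∀ Q R X → Q ⊓ R + (Q ∸ R) ⊓ X ≡ Q ⊓ (R + X)
  first-block Q R X with ≤-total Q R
  ... | inj₁ Q≤R = begin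
        Q ⊓ R + (Q ∸ R) ⊓ X ≡⟨ cong₂ _+_ (m≤n⇒m⊓n≡m Q≤R) (cong (_⊓ X) (m≤n⇒m∸n≡0 Q≤R)) ⟩
        Q + 0               ≡⟨ +-identityʳ Q ⟩
        Q                   ≡⟨ sym (m≤n⇒m⊓n≡m (≤-trans Q≤R (m≤m+n R X))) ⟩
        Q ⊓ (R + X)         ∎ where open ≡-Reasoning
  ... | inj₂ R≤Q = begin
        Q ⊓ R + (Q ∸ R) ⊓ X     ≡⟨ cong (_+ (Q ∸ R) ⊓ X) (m≥n⇒m⊓n≡n R≤Q) ⟩
        R + (Q ∸ R) ⊓ X         ≡⟨ +-distribˡ-⊓ R (Q ∸ R) X ⟩
        (R + (Q ∸ R)) ⊓ (R + X) ≡⟨ cong (_⊓ (R + X)) (m+[n∸m]≡n R≤Q) ⟩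
        Q ⊓ (R + X)             ∎ where open ≡-Reasoning

∑ₗ : ∀ {X : Set} → (X → ℕ) → List X → ℕ
∑ₗ h xs = sum (map h xs)

∑ₗ-applyUpTo : ∀ (h : ℕ → ℕ) f k → ∑ₗ h (applyUpTo f k) ≡ ∑< k (h ∘ f)
∑ₗ-applyUpTo h f zero = refl
∑ₗ-applyUpTo h f (suc k) = cong (h (f 0) +_) (∑ₗ-applyUpTo h (f ∘ suc) k)

∑ₗ-++ : ∀ {X : Set} (h : X → ℕ) xs ys → ∑ₗ h (xs ++ ys) ≡ ∑ₗ h xs + ∑ₗ h ys
∑ₗ-++ h xs ys = trans (cong sum (map-++ h xs ys)) (sum-++ (map h xs) (map h ys))

∑ₗ-concat : ∀ {X : Set} (h : X → ℕ) xss → ∑ₗ h (concat xss) ≡ ∑ₗ (∑ₗ h) xss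
∑ₗ-concat h [] = refl
∑ₗ-concat h (xs ∷ xss) = trans (∑ₗ-++ h xs _) (cong (∑ₗ h xs +_) (∑ₗ-concat h xss))

∑ₗ-map : ∀ {X Y : Set} (h : Y → ℕ) (f : X → Y) xs → ∑ₗ h (map f xs) ≡ ∑ₗ (h ∘ f) xs
∑ₗ-map h f xs = cong sum (sym (map-∘ xs))

∑ₗ-cong : ∀ {X : Set} {h g : X → ℕ} xs → (∀ x → h x ≡ g x) → ∑ₗ h xs ≡ ∑ₗ g xs
∑ₗ-cong xs e = cong sum (map-cong e xs)

∑ₗ-mono : ∀ {X : Set} {h g : X → ℕ} xs → (∀ x → h x ≤ g x) → ∑ₗ h xs ≤ ∑ₗ g xs
∑ₗ-mono [] e = z≤n
∑ₗ-mono (x ∷ xs) e = +-mono-≤ (e x) (∑ₗ-mono xs e)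

∑ₗ-when : ∀ {X : Set} {a} {P : Set a} (d : Dec P) (h : X → ℕ) xs → ∑ₗ (λ y → when d (h y)) xs ≡ when d (∑ₗ h xs)
∑ₗ-when (yes _) h xs = refl
∑ₗ-when (no _) h [] = refl
∑ₗ-when (no n) h (x ∷ xs) = ∑ₗ-when (no n) h xs

∑ₗ-filter : ∀ {X : Set} {a} {P : X → Set a} (P? : ∀ x → Dec (P x)) (h : X → ℕ) xs
          → ∑ₗ h (filter P? xs) ≡ ∑ₗ (λ y → when (P? y) (h y)) xs
∑ₗ-filter P? h [] = refl
∑ₗ-filter P? h (x ∷ xs) with P? x
... | yes _ = cong (h x +_) (∑ₗ-filter P? h xs)
... | no _ = ∑ₗ-filter P? h xs

∑ₗ-replicate : ∀ {X : Set} (h : X → ℕ) p xs → ∑ₗ h (concat (replicate p xs)) ≡ p * ∑ₗ h xs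
∑ₗ-replicate h zero xs = refl
∑ₗ-replicate h (suc p) xs = trans (∑ₗ-++ h xs _) (cong (∑ₗ h xs +_) (∑ₗ-replicate h p xs))

∑ₗ-length : ∀ {X : Set} (xs : List X) → length xs ≡ ∑ₗ (λ _ → 1) xs
∑ₗ-length [] = refl
∑ₗ-length (x ∷ xs) = cong suc (∑ₗ-length xs)

∑-lookup : ∀ {X : Set} (h : X → ℕ) (xs : List X) → ∑ (length xs) (λ j → h (L.lookup xs j)) ≡ ∑ₗ h xs
∑-lookup h [] = refl
∑-lookup h (x ∷ xs) = cong (h x +_) (∑-lookup h xs)

length-filter-tabulate : ∀ {a} {A : Set} {P : A → Set a} (P? : (x : A) → Dec (P x)) n (h : Fin n → A)
                       → length (filter P? (L.tabulate h)) ≡ ∑ n (λ j → when (P? (h j)) 1)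
length-filter-tabulate P? zero h = refl
length-filter-tabulate P? (suc n) h with P? (h zero)
... | yes _ = cong suc (length-filter-tabulate P? n (h ∘ suc))
... | no _ = length-filter-tabulate P? n (h ∘ suc)

module Occurrences {X : Set} (_≟X_ : (x y : X) → Dec (x ≡ y)) where

  occurrences : ∀ n → (Fin n → X) → X → ℕ
  occurrences n g y = ∑ n (λ a → when (g a ≟X y) 1)

  private
    self-occurs : ∀ l (f : Fin (suc l) → X) → 1 ≤ occurrences (suc l) f (f zero)
    self-occurs l f = subst (_≤ occurrences (suc l) f (f zero)) (when-yes (f zero ≟X f zero) 1 refl) (m≤m+n _ _)

  factor-through-injection : ∀ l n (f : Fin l → X) (g : Fin n → X)
    → (∀ j → occurrences l f (f j) ≤ occurrences n g (f j))
    → Σ (Fin l → Fin n) λ τ → Injective _≡_ _≡_ τ × (∀ j → g (τ j) ≡ f j)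
  factor-through-injection zero n f g h = (λ ()) , (λ {i} → ⊥-elim (¬Fin0 i)) , (λ ())
  factor-through-injection (suc l) zero f g h with ≤-trans (self-occurs l f) (h zero)
  ... | ()
  factor-through-injection (suc l) (suc n) f g h
    with ∑-positive (suc n) (λ a → when (g a ≟X f zero) 1) (≤-trans (self-occurs l f) (h zero))
  ... | a , ga-pos = τ , τ-injective , τ-factors
    where
    ga : g a ≡ f zero
    ga = when-pos (g a ≟X f zero) 1 ga-pos
    h′ : ∀ j → occurrences l (f ∘ suc) (f (suc j)) ≤ occurrences n (g ∘ punchIn a) (f (suc j))
    h′ j = +-cancelˡ-≤ (when (f zero ≟X y) 1) _ _
             (subst (when (f zero ≟X y) 1 + occurrences l (f ∘ suc) y ≤_)
                    (trans (∑-punch n (λ b → when (g b ≟X y) 1) a)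
                           (cong (_+ occurrences n (g ∘ punchIn a) y)
                                 (when-cong (g a ≟X y) (f zero ≟X y) 1 (trans (sym ga)) (trans ga))))
                    (h (suc j)))
      where y = f (suc j)
    rest = factor-through-injection l n (f ∘ suc) (g ∘ punchIn a) h′
    τ′ = proj₁ rest
    τ : Fin (suc l) → Fin (suc n)
    τ zero = a
    τ (suc j) = punchIn a (τ′ j)
    τ-injective : Injective _≡_ _≡_ τ
    τ-injective {zero} {zero} e = refl
    τ-injective {zero} {suc j} e = ⊥-elim (punchInᵢ≢i a (τ′ j) (sym e))
    τ-injective {suc i} {zero} e = ⊥-elim (punchInᵢ≢i a (τ′ i) e)
    τ-injective {suc i} {suc j} e = cong suc (proj₁ (proj₂ rest) (punchIn-injective a _ _ e))
    τ-factors : ∀ j → g (τ j) ≡ f j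
    τ-factors zero = ga
    τ-factors (suc j) = proj₂ (proj₂ rest) j

_≟v_ : ∀ {m} → (x y : Vec ℕ m) → Dec (x ≡ y)
_≟v_ = ≡-dec _≟_

col : ∀ {m n} → Mat m n → Fin n → Vec ℕ m
col A a = tabulate (λ i → A i a)

tabulate-injective : ∀ {m} (f g : Fin m → ℕ) → tabulate f ≡ tabulate g → ∀ i → f i ≡ g i
tabulate-injective f g e i = trans (sym (lookup∘tabulate f i)) (trans (cong (λ v → lookup v i) e) (lookup∘tabulate g i))

lookup-extensional : ∀ {m} (u v : Vec ℕ m) → (∀ i → lookup u i ≡ lookup v i) → u ≡ v
lookup-extensional u v e = trans (sym (tabulate∘lookup u)) (trans (tabulate-cong e) (tabulate∘lookup v))

Binary : ∀ {k} → (Fin k → ℕ) → Set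
Binary β = ∀ j → β j ≤ 1

Matches : ∀ {k m} → (Fin k → Fin m) → (Fin k → ℕ) → Vec ℕ m → Set
Matches σ β x = ∀ j → lookup x (σ j) ≡ β j

Matches? : ∀ {k m} (σ : Fin k → Fin m) (β : Fin k → ℕ) (x : Vec ℕ m) → Dec (Matches σ β x)
Matches? σ β x = all? (λ j → lookup x (σ j) ≟ β j)

onesOf : ∀ {k} → (Fin k → ℕ) → ℕ
onesOf {k} β = ∑ k (λ j → when (β j ≟ 1) 1)

-- The alphabet {0,…,r-1} with r = 2 + r″.  A simple m-rowed r-matrix is
-- recorded by its column indicator M : Vec ℕ m → ℕ, and total m M sums M over
-- all r^m columns.
module Alphabet (r″ : ℕ) where

  r : ℕ
  r = suc (suc r″)

  total : ∀ m → (Vec ℕ m → ℕ) → ℕ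
  total zero M = M []
  total (suc m) M = ∑< r (λ v → total m (λ x → M (v ∷ x)))

  total-cong : ∀ m {M N : Vec ℕ m → ℕ} → (∀ x → M x ≡ N x) → total m M ≡ total m N
  total-cong zero e = e []
  total-cong (suc m) e = ∑-cong r (λ v → total-cong m (λ x → e (toℕ v ∷ x)))

  total-mono : ∀ m {M N : Vec ℕ m → ℕ} → (∀ x → M x ≤ N x) → total m M ≤ total m N
  total-mono zero e = e []
  total-mono (suc m) e = ∑-mono r (λ v → total-mono m (λ x → e (toℕ v ∷ x)))

  total-+ : ∀ m (M N : Vec ℕ m → ℕ) → total m (λ x → M x + N x) ≡ total m M + total m N
  total-+ zero M N = refl
  total-+ (suc m) M N =
    trans (∑-cong r (λ v → total-+ m (λ x → M (toℕ v ∷ x)) (λ x → N (toℕ v ∷ x))))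
          (∑-+ r (λ v → total m (λ x → M (toℕ v ∷ x))) (λ v → total m (λ x → N (toℕ v ∷ x))))

  total-zero : ∀ m {M : Vec ℕ m → ℕ} → (∀ x → M x ≡ 0) → total m M ≡ 0
  total-zero zero h = h []
  total-zero (suc m) h = ∑-zero r _ (λ v → total-zero m (λ x → h (toℕ v ∷ x)))

  total-∑ : ∀ m n (M : Fin n → Vec ℕ m → ℕ) → total m (λ x → ∑ n (λ v → M v x)) ≡ ∑ n (λ v → total m (M v))
  total-∑ m zero M = total-zero m (λ _ → refl)
  total-∑ m (suc n) M =
    trans (total-+ m (M zero) (λ x → ∑ n (λ v → M (suc v) x))) (cong (total m (M zero) +_) (total-∑ m n (M ∘ suc)))

  InRange : ∀ {m} → Vec ℕ m → Set
  InRange x = ∀ i → lookup x i < r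

  total-point : ∀ m (c : Vec ℕ m) → InRange c → (h : Vec ℕ m → ℕ) → total m (λ x → when (c ≟v x) (h x)) ≡ h c
  total-point zero [] _ h = refl
  total-point (suc m) (v ∷ c) c-range h =
    trans (∑<-single r _ v (c-range zero) other-heads-vanish)
      (trans (total-cong m (λ x → when-cong ((v ∷ c) ≟v (v ∷ x)) (c ≟v x) (h (v ∷ x)) (cong tail) (cong (v ∷_))))
             (total-point m c (c-range ∘ suc) (λ x → h (v ∷ x))))
    where
    tail : ∀ {m} → Vec ℕ (suc m) → Vec ℕ m
    tail (_ ∷ x) = x
    head : ∀ {m} → Vec ℕ (suc m) → ℕ
    head (y ∷ _) = y
    other-heads-vanish : ∀ u → u ≢ v → total m (λ x → when ((v ∷ c) ≟v (u ∷ x)) (h (u ∷ x))) ≡ 0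
    other-heads-vanish u u≢v = total-zero m (λ x → when-no ((v ∷ c) ≟v (u ∷ x)) _ (λ e → u≢v (sym (cong head e))))

  G : ℕ → ℕ → ℕ
  G m zero = 0
  G zero (suc k) = 1
  G (suc m) (suc k) = G m k + suc r″ * G m (suc k)

  G-closed-form : ∀ m k → G m k ≡ sum (map (λ n → (m C n) * (r ∸ 1) ^ (m ∸ n)) (upTo k))
  G-closed-form m k = trans (G≡∑ m k) (sym (∑ₗ-applyUpTo _ id k))
    where
    ρ = suc r″
    term : ℕ → ℕ → ℕ
    term m n = (m C n) * ρ ^ (m ∸ n)
    ∸-suc : ∀ m k → k < m → m ∸ k ≡ suc (m ∸ suc k)
    ∸-suc (suc m) zero _ = refl
    ∸-suc (suc m) (suc k) (s≤s k<m) = ∸-suc m k k<m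
    shift : ∀ m n → ρ * term m (suc n) ≡ (m C suc n) * ρ ^ (m ∸ n)
    shift m n with suc n ≤? m
    ... | yes n<m rewrite ∸-suc m n n<m = rearrange (m C suc n) ρ (ρ ^ (m ∸ suc n))
      where rearrange : ∀ c x y → x * (c * y) ≡ c * (x * y)
            rearrange = solve-∀
    ... | no n≮m rewrite k>n⇒nCk≡0 {m} {suc n} (≰⇒> n≮m) = *-zeroʳ ρ
    pascal : ∀ m n → term m n + (m C suc n) * ρ ^ (m ∸ n) ≡ term (suc m) (suc n)
    pascal m n = trans (sym (*-distribʳ-+ (ρ ^ (m ∸ n)) (m C n) (m C suc n)))
                       (cong (_* ρ ^ (m ∸ n)) (nCk+nC[k+1]≡[n+1]C[k+1] m n))
    G≡∑ : ∀ m k → G m k ≡ ∑< k (term m)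
    G≡∑ m zero = refl
    G≡∑ zero (suc k) = cong suc (sym (∑-zero k _ (λ _ → refl)))
    G≡∑ (suc m) (suc k) = begin
        G m k + ρ * G m (suc k)
      ≡⟨ cong₂ (λ x y → x + ρ * y) (G≡∑ m k) (G≡∑ m (suc k)) ⟩
        ∑< k (term m) + ρ * (term m 0 + ∑< k (term m ∘ suc))
      ≡⟨ cong (∑< k (term m) +_)
              (trans (*-distribˡ-+ ρ (term m 0) _)
                     (cong (ρ * term m 0 +_) (trans (sym (∑<-* k ρ (term m ∘ suc))) (∑-cong k (λ n → shift m (toℕ n)))))) ⟩
        ∑< k (term m) + (ρ * term m 0 + ∑< k (λ n → (m C suc n) * ρ ^ (m ∸ n)))
      ≡⟨ +-swap (∑< k (term m)) (ρ * term m 0) _ ⟩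
        ρ * term m 0 + (∑< k (term m) + ∑< k (λ n → (m C suc n) * ρ ^ (m ∸ n)))
      ≡⟨ cong₂ _+_ (first-term (ρ ^ m) ρ) (trans (sym (∑-+ k _ _)) (∑-cong k (λ n → pascal m (toℕ n)))) ⟩
        term (suc m) 0 + ∑< k (term (suc m) ∘ suc) ∎
      where
      open ≡-Reasoning
      +-swap : ∀ a b c → a + (b + c) ≡ b + (a + c)
      +-swap = solve-∀
      first-term : ∀ x y → y * (1 * x) ≡ 1 * (y * x)
      first-term = solve-∀

module UpperBound (r″ p : ℕ) where
  open Alphabet r″

  -- Standard induction on the first row: the columns starting with 0 and with 1
  -- are paired up, their pointwise minimum forms the low part, and everything
  -- else (the excess of 0/1-columns and the columns starting with 2,…,r-1)
  -- forms the high part.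
  zeroPart onePart lowPart highPart : ∀ {m} → (Vec ℕ (suc m) → ℕ) → Vec ℕ m → ℕ
  zeroPart M x = M (0 ∷ x)
  onePart M x = M (1 ∷ x)
  lowPart M x = zeroPart M x ⊓ onePart M x
  highPart M x = zeroPart M x ⊔ onePart M x + ∑< r″ (λ v → M (suc (suc v) ∷ x))

  low+high : ∀ {m} (M : Vec ℕ (suc m) → ℕ) x → ∑< r (λ v → M (v ∷ x)) ≡ lowPart M x + highPart M x
  low+high M x = begin
      M (0 ∷ x) + (M (1 ∷ x) + rest)
    ≡⟨ sym (+-assoc (M (0 ∷ x)) _ _) ⟩
      M (0 ∷ x) + M (1 ∷ x) + rest
    ≡⟨ cong (_+ rest) (sym (⊓+⊔ (M (0 ∷ x)) (M (1 ∷ x)))) ⟩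
      lowPart M x + (M (0 ∷ x) ⊔ M (1 ∷ x)) + rest
    ≡⟨ +-assoc (lowPart M x) _ _ ⟩
      lowPart M x + highPart M x ∎
    where
    open ≡-Reasoning
    rest = ∑< r″ (λ v → M (suc (suc v) ∷ x))
    ⊓+⊔ : ∀ a b → a ⊓ b + (a ⊔ b) ≡ a + b
    ⊓+⊔ a b with ≤-total a b
    ... | inj₁ a≤b = cong₂ _+_ (m≤n⇒m⊓n≡m a≤b) (m≤n⇒m⊔n≡n a≤b)
    ... | inj₂ b≤a = trans (cong₂ _+_ (m≥n⇒m⊓n≡n b≤a) (m≥n⇒m⊔n≡m b≤a)) (+-comm b a)

  total-split : ∀ m (M : Vec ℕ (suc m) → ℕ) → total (suc m) M ≡ total m (lowPart M) + total m (highPart M)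
  total-split m M = begin
      total (suc m) M
    ≡⟨ sym (total-∑ m r (λ v x → M (toℕ v ∷ x))) ⟩
      total m (λ x → ∑< r (λ v → M (v ∷ x)))
    ≡⟨ total-cong m (low+high M) ⟩
      total m (λ x → lowPart M x + highPart M x)
    ≡⟨ total-+ m _ _ ⟩
      total m (lowPart M) + total m (highPart M) ∎
    where open ≡-Reasoning

  Rich : ∀ m → (Vec ℕ m → ℕ) → ℕ → Set
  Rich m M zero = p ≤ total m M
  Rich zero M (suc k) = ⊥
  Rich (suc m) M (suc k) = Rich m (lowPart M) k ⊎ Rich m (highPart M) (suc k)

  total-bound : ∀ m k q (M : Vec ℕ m → ℕ) → (∀ x → M x ≤ q) → ¬ Rich m M k
              → total m M ≤ q * G m k + (p ∸ 1) * (m C k)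
  total-bound m zero q M M≤q poor =
    subst (total m M ≤_) (sym (trans (cong (_+ (p ∸ 1) * 1) (*-zeroʳ q)) (*-identityʳ (p ∸ 1))))
      (∸-monoˡ-≤ 1 (≰⇒> poor))
  total-bound zero (suc k) q M M≤q poor =
    subst (M [] ≤_) (sym (trans (cong₂ _+_ (*-identityʳ q) (*-zeroʳ (p ∸ 1))) (+-identityʳ q))) (M≤q [])
  total-bound (suc m) (suc k) q M M≤q poor = begin
      total (suc m) M
    ≡⟨ total-split m M ⟩
      total m (lowPart M) + total m (highPart M)
    ≤⟨ +-mono-≤ (total-bound m k q (lowPart M) low≤q (poor ∘ inj₁))
                (total-bound m (suc k) (suc r″ * q) (highPart M) high≤ (poor ∘ inj₂)) ⟩
      q * G m k + (p ∸ 1) * (m C k) + ((suc r″ * q) * G m (suc k) + (p ∸ 1) * (m C suc k))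
    ≡⟨ regroup q (G m k) (G m (suc k)) r″ (p ∸ 1) (m C k) (m C suc k) ⟩
      q * (G m k + suc r″ * G m (suc k)) + (p ∸ 1) * (m C k + m C suc k)
    ≡⟨ cong (λ z → q * G (suc m) (suc k) + (p ∸ 1) * z) (nCk+nC[k+1]≡[n+1]C[k+1] m k) ⟩
      q * G (suc m) (suc k) + (p ∸ 1) * (suc m C suc k) ∎
    where
    open ≤-Reasoning
    regroup : ∀ q A B R c X Y → q * A + c * X + ((suc R * q) * B + c * Y) ≡ q * (A + suc R * B) + c * (X + Y)
    regroup = solve-∀
    low≤q : ∀ x → lowPart M x ≤ q
    low≤q x = ≤-trans (m⊓n≤m _ _) (M≤q (0 ∷ x))
    high≤ : ∀ x → highPart M x ≤ suc r″ * q
    high≤ x = +-mono-≤ (⊔-lub (M≤q (0 ∷ x)) (M≤q (1 ∷ x))) (∑<-bound r″ _ q (λ v → M≤q (suc (suc v) ∷ x)))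

  restrict : ∀ {k m} → (Fin k → Fin m) → (Fin k → ℕ) → (Vec ℕ m → ℕ) → Vec ℕ m → ℕ
  restrict σ β M x = when (Matches? σ β x) (M x)

  Shattering : ∀ m → (Vec ℕ m → ℕ) → ℕ → Set
  Shattering m M k = Σ (Fin k → Fin m) λ σ → Injective _≡_ _≡_ σ × (∀ β → Binary β → p ≤ total m (restrict σ β M))

  rich⇒shattering : ∀ m M k → Rich m M k → Shattering m M k
  rich⇒shattering m M zero rich = (λ ()) , (λ {i} → ⊥-elim (¬Fin0 i)) ,
    (λ β _ → subst (p ≤_) (sym (total-cong m (λ x → when-yes (Matches? (λ ()) β x) (M x) (λ ())))) rich)
  -- A low-part witness gains the first row: a pattern starting with b₀ ∈ {0,1}
  -- is shown by the columns starting with b₀ at least as often as by the low part.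
  rich⇒shattering (suc m) M (suc k) (inj₁ rich) with rich⇒shattering m (lowPart M) k rich
  ... | σ′ , σ′-injective , shattered = σ , σ-injective , shown
    where
    σ : Fin (suc k) → Fin (suc m)
    σ zero = zero
    σ (suc j) = suc (σ′ j)
    σ-injective : Injective _≡_ _≡_ σ
    σ-injective {zero} {zero} e = refl
    σ-injective {suc i} {suc j} e = cong suc (σ′-injective (suc-injective e))
    low≤ : ∀ x v → v ≤ 1 → lowPart M x ≤ M (v ∷ x)
    low≤ x zero _ = m⊓n≤m _ _
    low≤ x (suc zero) _ = m⊓n≤n _ _
    low≤ x (suc (suc v)) (s≤s ())
    shown : ∀ β → Binary β → p ≤ total (suc m) (restrict σ β M)
    shown β β-binary =
      ≤-trans (shattered (β ∘ suc) (β-binary ∘ suc))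
        (≤-trans (total-mono m pointwise)
                 (∑<-term r (λ v → total m (λ x → restrict σ β M (v ∷ x))) (β zero) (s≤s (≤-trans (β-binary zero) (s≤s z≤n)))))
      where
      pointwise : ∀ x → restrict σ′ (β ∘ suc) (lowPart M) x ≤ restrict σ β M (β zero ∷ x)
      pointwise x = when-mono (Matches? σ′ (β ∘ suc) x) (Matches? σ β (β zero ∷ x)) extend (low≤ x (β zero) (β-binary zero))
        where
        extend : Matches σ′ (β ∘ suc) x → Matches σ β (β zero ∷ x)
        extend h zero = refl
        extend h (suc j) = h j
  -- A high-part witness avoids the first row: the high part is below the sum
  -- over all first entries.
  rich⇒shattering (suc m) M (suc k) (inj₂ rich) with rich⇒shattering m (highPart M) (suc k) rich
  ... | σ′ , σ′-injective , shattered = suc ∘ σ′ , σ′-injective ∘ suc-injective , shown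
    where
    shown : ∀ β → Binary β → p ≤ total (suc m) (restrict (suc ∘ σ′) β M)
    shown β β-binary = ≤-trans (shattered β β-binary)
      (subst (total m (restrict σ′ β (highPart M)) ≤_) (total-∑ m r (λ v x → restrict (suc ∘ σ′) β M (toℕ v ∷ x)))
             (total-mono m pointwise))
      where
      pointwise : ∀ x → restrict σ′ β (highPart M) x ≤ ∑< r (λ v → restrict (suc ∘ σ′) β M (v ∷ x))
      pointwise x = begin
          when (Matches? σ′ β x) (highPart M x)
        ≤⟨ when-mono (Matches? σ′ β x) (Matches? σ′ β x) id
                     (≤-trans (m≤n+m _ (lowPart M x)) (≤-reflexive (sym (low+high M x)))) ⟩
          when (Matches? σ′ β x) (∑< r (λ v → M (v ∷ x)))
        ≡⟨ sym (∑-when (Matches? σ′ β x) r (λ v → M (toℕ v ∷ x))) ⟩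
          ∑< r (λ v → when (Matches? σ′ β x) (M (v ∷ x)))
        ≤⟨ ∑-mono r (λ v → when-mono (Matches? σ′ β x) (Matches? (suc ∘ σ′) β (toℕ v ∷ x)) {M (toℕ v ∷ x)} id ≤-refl) ⟩
          ∑< r (λ v → restrict (suc ∘ σ′) β M (v ∷ x)) ∎
        where open ≤-Reasoning

  module ColumnsOf {m n} (A : Mat m n) (A-range : IsRMatrix r A) where

    columnCount : Vec ℕ m → ℕ
    columnCount x = ∑ n (λ a → when (col A a ≟v x) 1)

    total-weighted : ∀ (D : Vec ℕ m → ℕ) → total m (λ x → ∑ n (λ a → when (col A a ≟v x) (D x))) ≡ ∑ n (λ a → D (col A a))
    total-weighted D = trans (total-∑ m n (λ a x → when (col A a ≟v x) (D x)))
                             (∑-cong n (λ a → total-point m (col A a) (col-range a) D))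
      where
      col-range : ∀ a i → lookup (col A a) i < r
      col-range a i = subst (_< r) (sym (lookup∘tabulate (λ i → A i a) i)) (A-range i a)

    total-columnCount : total m columnCount ≡ n
    total-columnCount = trans (total-weighted (λ _ → 1)) (∑-count n)

    total-restrict : ∀ {k} (σ : Fin k → Fin m) β → total m (restrict σ β columnCount) ≡ ∑ n (λ a → when (Matches? σ β (col A a)) 1)
    total-restrict σ β = trans (total-cong m pointwise) (total-weighted (λ x → when (Matches? σ β x) 1))
      where
      pointwise : ∀ x → restrict σ β columnCount x ≡ ∑ n (λ a → when (col A a ≟v x) (when (Matches? σ β x) 1))
      pointwise x = trans (sym (∑-when (Matches? σ β x) n _)) (∑-cong n (λ a → when-comm (Matches? σ β x) (col A a ≟v x) 1))

    columnCount-≤1 : Simple A → ∀ x → columnCount x ≤ 1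
    columnCount-≤1 A-simple x = ∑-≤1 n _ (λ a → when-≤ (col A a ≟v x) 1)
      (λ a a′ pa pa′ → A-simple a a′ (tabulate-injective _ _
         (trans (when-pos (col A a ≟v x) 1 pa) (sym (when-pos (col A a′ ≟v x) 1 pa′)))))

    -- Shattered rows contain every p-simple (0,1)-matrix: each column of F occurs
    -- at most p times in F and at least p times among the columns of A on σ.
    shattering⇒contains : ∀ {k l} (F : Mat k l) → IsRMatrix 2 F → PSimple p F → Shattering m columnCount k → F ≺ A
    shattering⇒contains {k} {l} F F-binary F-simple (σ , σ-injective , shattered) =
      σ , proj₁ τ , σ-injective , proj₁ (proj₂ τ) , λ i j → tabulate-injective _ _ (proj₂ (proj₂ τ) j) i
      where
      open Occurrences (_≟v_ {k})
      onRows : Fin n → Vec ℕ k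
      onRows a = tabulate (λ i → A (σ i) a)
      enough : ∀ j → occurrences l (col F) (col F j) ≤ occurrences n onRows (col F j)
      enough j = ≤-trans in-F (≤-trans (shattered β β-binary) (≤-reflexive in-A))
        where
        β : Fin k → ℕ
        β i = F i j
        β-binary : Binary β
        β-binary i = ≤-pred (F-binary i j)
        in-F : occurrences l (col F) (col F j) ≤ p
        in-F = subst (_≤ p) (trans (length-filter-tabulate (ColEq? F j) l id)
                 (∑-cong l (λ j′ → when-cong (ColEq? F j j′) (col F j′ ≟v col F j) 1
                    (λ e → tabulate-cong (λ i → sym (e i))) (λ e i → sym (tabulate-injective _ _ e i))))) (F-simple j)
        in-A : total m (restrict σ β columnCount) ≡ occurrences n onRows (col F j)
        in-A = trans (total-restrict σ β) (∑-cong n (λ a → when-cong (Matches? σ β (col A a)) (onRows a ≟v col F j) 1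
                 (λ e → tabulate-cong (λ i → trans (sym (lookup∘tabulate (λ i → A i a) (σ i))) (e i)))
                 (λ e i → trans (lookup∘tabulate (λ i → A i a) (σ i)) (tabulate-injective _ _ e i))))
      τ = factor-through-injection l n (col F) onRows enough

  upper-bound : ∀ {k l m n} (F : Mat k l) → IsRMatrix 2 F → PSimple p F
              → (A : Mat m n) → IsRMatrix r A → Simple A → Avoids A F
              → n ≤ G m k + (p ∸ 1) * (m C k)
  upper-bound {k} {l} {m} {n} F F-binary F-simple A A-range A-simple A-avoids =
    subst₂ _≤_ total-columnCount (cong (_+ (p ∸ 1) * (m C k)) (*-identityˡ (G m k)))
      (total-bound m k 1 columnCount (columnCount-≤1 A-simple)
        (λ rich → A-avoids (shattering⇒contains F F-binary F-simple (rich⇒shattering m columnCount k rich))))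
    where open ColumnsOf A A-range

module ColumnWords (r″ : ℕ) where
  open Alphabet r″

  -- AvoidsWord x a b: the (0,1)-entries of x, read from the top, do not contain
  -- the word 0^a 1^b as a subsequence (decided by greedy matching).
  AvoidsWord : ∀ {m} → Vec ℕ m → ℕ → ℕ → Set
  AvoidsWord x zero zero = ⊥
  AvoidsWord [] (suc a) b = ⊤
  AvoidsWord [] zero (suc b) = ⊤
  AvoidsWord (zero ∷ x) (suc a) b = AvoidsWord x a b
  AvoidsWord (suc v ∷ x) (suc a) b = AvoidsWord x (suc a) b
  AvoidsWord (suc zero ∷ x) zero (suc b) = AvoidsWord x zero b
  AvoidsWord (zero ∷ x) zero (suc b) = AvoidsWord x zero (suc b)
  AvoidsWord (suc (suc v) ∷ x) zero (suc b) = AvoidsWord x zero (suc b)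

  AvoidsWord? : ∀ {m} (x : Vec ℕ m) a b → Dec (AvoidsWord x a b)
  AvoidsWord? x zero zero = no (λ ())
  AvoidsWord? [] (suc a) b = yes tt
  AvoidsWord? [] zero (suc b) = yes tt
  AvoidsWord? (zero ∷ x) (suc a) b = AvoidsWord? x a b
  AvoidsWord? (suc v ∷ x) (suc a) b = AvoidsWord? x (suc a) b
  AvoidsWord? (suc zero ∷ x) zero (suc b) = AvoidsWord? x zero b
  AvoidsWord? (zero ∷ x) zero (suc b) = AvoidsWord? x zero (suc b)
  AvoidsWord? (suc (suc v) ∷ x) zero (suc b) = AvoidsWord? x zero (suc b)

  -- Exactly G m (a + b) columns avoid 0^a 1^b: this is the recurrence defining G.
  count-avoiders : ∀ m a b → total m (λ x → when (AvoidsWord? x a b) 1) ≡ G m (a + b)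
  count-avoiders zero zero zero = refl
  count-avoiders zero zero (suc b) = refl
  count-avoiders zero (suc a) b = refl
  count-avoiders (suc m) zero zero = ∑-zero r _ (λ v → total-zero m (λ x → refl))
  count-avoiders (suc m) (suc a) b =
    cong₂ _+_ (count-avoiders m a b) (trans (∑-cong (suc r″) (λ v → count-avoiders m (suc a) b)) (∑<-const (suc r″) _))
  count-avoiders (suc m) zero (suc b) =
    trans (cong₂ _+_ (count-avoiders m zero (suc b))
                     (cong₂ _+_ (count-avoiders m zero b) (trans (∑-cong r″ (λ v → count-avoiders m zero (suc b))) (∑<-const r″ _))))
          (+-swap (G m (suc b)) (G m b) (r″ * G m (suc b)))
    where
    +-swap : ∀ a b c → a + (b + c) ≡ b + (a + c)
    +-swap = solve-∀

  -- CarriesWord x a b q: the (0,1)-entries of x form exactly the word 0^a 1^b, and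
  -- the other entries, read as a number in base r-2 (entry 2+w is the digit w),
  -- are below q.
  CarriesWord : ∀ {m} → Vec ℕ m → ℕ → ℕ → ℕ → Set
  CarriesWord [] zero zero q = 1 ≤ q
  CarriesWord [] zero (suc b) q = ⊥
  CarriesWord [] (suc a) b q = ⊥
  CarriesWord (zero ∷ x) (suc a) b q = CarriesWord x a b q
  CarriesWord (zero ∷ x) zero b q = ⊥
  CarriesWord (suc zero ∷ x) zero (suc b) q = CarriesWord x zero b q
  CarriesWord (suc zero ∷ x) (suc a) b q = ⊥
  CarriesWord (suc zero ∷ x) zero zero q = ⊥
  CarriesWord {suc m} (suc (suc w) ∷ x) a b q = CarriesWord x a b (q ∸ w * r″ ^ (m ∸ (a + b)))

  CarriesWord? : ∀ {m} (x : Vec ℕ m) a b q → Dec (CarriesWord x a b q)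
  CarriesWord? [] zero zero q = 1 ≤? q
  CarriesWord? [] zero (suc b) q = no (λ ())
  CarriesWord? [] (suc a) b q = no (λ ())
  CarriesWord? (zero ∷ x) (suc a) b q = CarriesWord? x a b q
  CarriesWord? (zero ∷ x) zero b q = no (λ ())
  CarriesWord? (suc zero ∷ x) zero (suc b) q = CarriesWord? x zero b q
  CarriesWord? (suc zero ∷ x) (suc a) b q = no (λ ())
  CarriesWord? (suc zero ∷ x) zero zero q = no (λ ())
  CarriesWord? {suc m} (suc (suc w) ∷ x) a b q = CarriesWord? x a b (q ∸ w * r″ ^ (m ∸ (a + b)))

  carriers : ∀ m a b q → ℕ
  carriers m a b q = total m (λ x → when (CarriesWord? x a b q) 1)

  -- Pascal's rule for the carrier count when the first row either holds the
  -- first letter of the word or a filler digit.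
  word-placed : ∀ m k q → (m C k) * (q ⊓ r″ ^ (m ∸ k)) + (m C suc k) * (q ⊓ (r″ * r″ ^ (m ∸ suc k)))
                         ≡ (suc m C suc k) * (q ⊓ r″ ^ (suc m ∸ suc k))
  word-placed m k q = begin
      (m C k) * M + (m C suc k) * (q ⊓ (r″ * r″ ^ (m ∸ suc k)))
    ≡⟨ cong ((m C k) * M +_) shift-exponent ⟩
      (m C k) * M + (m C suc k) * M
    ≡⟨ sym (*-distribʳ-+ M (m C k) (m C suc k)) ⟩
      (m C k + m C suc k) * M
    ≡⟨ cong (_* M) (nCk+nC[k+1]≡[n+1]C[k+1] m k) ⟩
      (suc m C suc k) * M ∎
    where
    open ≡-Reasoning
    M = q ⊓ r″ ^ (m ∸ k)
    ∸-suc : ∀ m k → k < m → m ∸ k ≡ suc (m ∸ suc k)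
    ∸-suc (suc m) zero _ = refl
    ∸-suc (suc m) (suc k) (s≤s k<m) = ∸-suc m k k<m
    shift-exponent : (m C suc k) * (q ⊓ (r″ * r″ ^ (m ∸ suc k))) ≡ (m C suc k) * M
    shift-exponent with suc k ≤? m
    ... | yes k<m = cong (λ e → (m C suc k) * (q ⊓ r″ ^ e)) (sym (∸-suc m k k<m))
    ... | no k≮m rewrite k>n⇒nCk≡0 {m} {suc k} (≰⇒> k≮m) = refl

  -- Each of the C(m,a+b) position sets for the word carries min(q, (r-2)^{m-a-b})
  -- columns; the second equation sums over the leading digit 2+w.
  mutual
    count-carriers : ∀ m a b q → carriers m a b q ≡ (m C (a + b)) * (q ⊓ r″ ^ (m ∸ (a + b)))
    count-carriers zero zero zero zero = refl
    count-carriers zero zero zero (suc q) = cong (λ z → suc z + 0) (sym (⊓-zeroʳ q))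
    count-carriers zero zero (suc b) q = refl
    count-carriers zero (suc a) b q = refl
    count-carriers (suc m) zero zero q =
      cong₂ _+_ (total-zero m (λ _ → refl)) (cong₂ _+_ (total-zero m (λ _ → refl)) (count-filled m zero zero q))
    count-carriers (suc m) (suc a) b q =
      trans (cong₂ _+_ (count-carriers m a b q) (cong₂ _+_ (total-zero m (λ _ → refl)) (count-filled m (suc a) b q)))
            (word-placed m (a + b) q)
    count-carriers (suc m) zero (suc b) q =
      trans (cong₂ _+_ (total-zero m (λ _ → refl)) (cong₂ _+_ (count-carriers m zero b q) (count-filled m zero (suc b) q)))
            (word-placed m b q)

    count-filled : ∀ m a b q → ∑< r″ (λ w → carriers m a b (q ∸ w * r″ ^ (m ∸ (a + b))))
                                 ≡ (m C (a + b)) * (q ⊓ (r″ * r″ ^ (m ∸ (a + b))))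
    count-filled m a b q = begin
        ∑< r″ (λ w → carriers m a b (q ∸ w * R))
      ≡⟨ ∑-cong r″ (λ w → count-carriers m a b (q ∸ toℕ w * R)) ⟩
        ∑< r″ (λ w → (m C (a + b)) * ((q ∸ w * R) ⊓ R))
      ≡⟨ ∑<-* r″ (m C (a + b)) (λ w → (q ∸ w * R) ⊓ R) ⟩
        (m C (a + b)) * ∑< r″ (λ w → (q ∸ w * R) ⊓ R)
      ≡⟨ cong ((m C (a + b)) *_) (∑<-blocks r″ q R) ⟩
        (m C (a + b)) * (q ⊓ (r″ * R)) ∎
      where
      open ≡-Reasoning
      R = r″ ^ (m ∸ (a + b))

  carries⇒¬avoids : ∀ {m} (x : Vec ℕ m) a b q → CarriesWord x a b q → ¬ AvoidsWord x a b
  carries⇒¬avoids [] zero zero q c ()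
  carries⇒¬avoids (zero ∷ x) (suc a) b q c = carries⇒¬avoids x a b q c
  carries⇒¬avoids (suc zero ∷ x) zero (suc b) q c = carries⇒¬avoids x zero b q c
  carries⇒¬avoids (suc (suc w) ∷ x) zero zero q c ()
  carries⇒¬avoids (suc (suc w) ∷ x) (suc a) b q c = carries⇒¬avoids x (suc a) b _ c
  carries⇒¬avoids (suc (suc w) ∷ x) zero (suc b) q c = carries⇒¬avoids x zero (suc b) _ c

  mutual
    avoids-0∷ : ∀ {m} (x : Vec ℕ m) a b → AvoidsWord x a b → AvoidsWord x (suc a) b
    avoids-0∷ [] a b h = tt
    avoids-0∷ (zero ∷ x) (suc a) b h = avoids-0∷ x a b h
    avoids-0∷ (suc v ∷ x) (suc a) b h = avoids-0∷ x (suc a) b h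
    avoids-0∷ (zero ∷ x) zero (suc b) h = h
    avoids-0∷ (suc zero ∷ x) zero (suc b) h = avoids-0∷ x zero (suc b) (avoids-∷1 x zero b h)
    avoids-0∷ (suc (suc v) ∷ x) zero (suc b) h = avoids-0∷ x zero (suc b) h

    avoids-∷1 : ∀ {m} (x : Vec ℕ m) a b → AvoidsWord x a b → AvoidsWord x a (suc b)
    avoids-∷1 x zero zero ()
    avoids-∷1 [] zero (suc b) h = tt
    avoids-∷1 [] (suc a) b h = tt
    avoids-∷1 (zero ∷ x) (suc a) b h = avoids-∷1 x a b h
    avoids-∷1 (suc v ∷ x) (suc a) b h = avoids-∷1 x (suc a) b h
    avoids-∷1 (zero ∷ x) zero (suc b) h = avoids-∷1 x zero (suc b) h
    avoids-∷1 (suc zero ∷ x) zero (suc b) h = avoids-∷1 x zero b h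
    avoids-∷1 (suc (suc v) ∷ x) zero (suc b) h = avoids-∷1 x zero (suc b) h

  avoids-tail : ∀ {m} v (x : Vec ℕ m) a b → AvoidsWord (v ∷ x) a b → AvoidsWord x a b
  avoids-tail zero x (suc a) b h = avoids-0∷ x a b h
  avoids-tail (suc v) x (suc a) b h = h
  avoids-tail (suc zero) x zero (suc b) h = avoids-∷1 x zero b h
  avoids-tail zero x zero (suc b) h = h
  avoids-tail (suc (suc v)) x zero (suc b) h = h

  binaryCount : ∀ {m} → Vec ℕ m → ℕ
  binaryCount {m} x = ∑ m (λ i → when (lookup x i ≤? 1) 1)

  carrier-binaryCount : ∀ {m} (x : Vec ℕ m) a b q → CarriesWord x a b q → binaryCount x ≡ a + b
  carrier-binaryCount [] zero zero q c = refl
  carrier-binaryCount (zero ∷ x) (suc a) b q c = cong suc (carrier-binaryCount x a b q c)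
  carrier-binaryCount (suc zero ∷ x) zero (suc b) q c = cong suc (carrier-binaryCount x zero b q c)
  carrier-binaryCount (suc (suc w) ∷ x) a b q c = carrier-binaryCount x a b _ c

  showing⇒binaryCount : ∀ {k m} (σ : Fin k → Fin m) → Injective _≡_ _≡_ σ → (x : Vec ℕ m)
                      → (∀ j → lookup x (σ j) ≤ 1) → k ≤ binaryCount x
  showing⇒binaryCount {k} {m} σ σ-injective x binary = subst (_≤ binaryCount x) (∑-count k)
    (∑-injection k m σ σ-injective (λ _ → 1) _ (λ j → ≤-reflexive (sym (when-yes (lookup x (σ j) ≤? 1) 1 (binary j)))))

HitsRowZero : ∀ {k m} → (Fin k → Fin (suc m)) → Set
HitsRowZero {k} σ = Σ (Fin k) λ i → σ i ≡ zero

hitsRowZero? : ∀ {k m} (σ : Fin k → Fin (suc m)) → Dec (HitsRowZero σ)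
hitsRowZero? σ = any? (λ i → σ i ≟ᶠ zero)

module MissesRowZero {k m} (σ : Fin k → Fin (suc m)) (misses : ¬ HitsRowZero σ) where

  lower : Fin k → Fin m
  lower j = punchOut {i = zero} {j = σ j} (λ e → misses (j , sym e))

  lower-eq : ∀ j → σ j ≡ suc (lower j)
  lower-eq j = sym (punchIn-punchOut {i = zero} {j = σ j} (λ e → misses (j , sym e)))

  lower-injective : Injective _≡_ _≡_ σ → Injective _≡_ _≡_ lower
  lower-injective σ-injective {i} {j} e = σ-injective (trans (lower-eq i) (trans (cong suc e) (sym (lower-eq j))))

  lower-matches : ∀ {β v} {x : Vec ℕ m} → Matches σ β (v ∷ x) → Matches lower β x
  lower-matches {β} {v} {x} h j = subst (λ z → lookup (v ∷ x) z ≡ β j) (lower-eq j) (h j)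

module HitsRowZeroAt {k m} (σ : Fin (suc k) → Fin (suc m)) (σ-injective : Injective _≡_ _≡_ σ)
                     (i₀ : Fin (suc k)) (σi₀≡0 : σ i₀ ≡ zero) where

  private
    0≢others : ∀ j → zero ≢ σ (punchIn i₀ j)
    0≢others j e = punchInᵢ≢i i₀ j (σ-injective (trans (sym e) (sym σi₀≡0)))

  others : Fin k → Fin m
  others j = punchOut (0≢others j)

  others-eq : ∀ j → σ (punchIn i₀ j) ≡ suc (others j)
  others-eq j = sym (punchIn-punchOut (0≢others j))

  others-injective : Injective _≡_ _≡_ others
  others-injective {i} {j} e = punchIn-injective i₀ i j (σ-injective (trans (others-eq i) (trans (cong suc e) (sym (others-eq j)))))

  head-matches : ∀ {β v} {x : Vec ℕ m} → Matches σ β (v ∷ x) → v ≡ β i₀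
  head-matches {β} {v} {x} h = subst (λ z → lookup (v ∷ x) z ≡ β i₀) σi₀≡0 (h i₀)

  others-match : ∀ {β v} {x : Vec ℕ m} → Matches σ β (v ∷ x) → Matches others (β ∘ punchIn i₀) x
  others-match {β} {v} {x} h j = subst (λ z → lookup (v ∷ x) z ≡ β (punchIn i₀ j)) (others-eq j) (h (punchIn i₀ j))

insertAt-binary : ∀ {k} (g : Fin k → ℕ) (i₀ : Fin (suc k)) c → c ≤ 1 → Binary g → Binary (insertAt g i₀ c)
insertAt-binary g i₀ c c≤1 g-binary j with j ≟ᶠ i₀
... | yes refl = subst (_≤ 1) (sym (insertAt-lookup g i₀ c)) c≤1
... | no j≢i₀ = subst (λ z → insertAt g i₀ c z ≤ 1) (punchIn-punchOut (j≢i₀ ∘ sym))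
                  (subst (_≤ 1) (sym (insertAt-punchIn g i₀ c (punchOut (j≢i₀ ∘ sym)))) (g-binary _))

onesOf-insertAt : ∀ {k} (g : Fin k → ℕ) (i₀ : Fin (suc k)) c → onesOf (insertAt g i₀ c) ≡ when (c ≟ 1) 1 + onesOf g
onesOf-insertAt {k} g i₀ c =
  trans (∑-punch k (λ j → when (insertAt g i₀ c j ≟ 1) 1) i₀)
        (cong₂ _+_ (cong (λ z → when (z ≟ 1) 1) (insertAt-lookup g i₀ c))
                   (∑-cong k (λ j → cong (λ z → when (z ≟ 1) 1) (insertAt-punchIn g i₀ c j))))

-- The pattern of the word 0^a 1^b along σ: the a selected rows nearest the top
-- get 0 and the remaining b get 1.
mutual
  wordPattern : ∀ m a b (σ : Fin (a + b) → Fin m) → Injective _≡_ _≡_ σ → Fin (a + b) → ℕ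
  wordPattern zero a b σ _ j with σ j
  ... | ()
  wordPattern (suc m) a b σ σ-injective = wordPattern-at m a b σ σ-injective (hitsRowZero? σ)

  wordPattern-at : ∀ m a b (σ : Fin (a + b) → Fin (suc m)) → Injective _≡_ _≡_ σ → Dec (HitsRowZero σ) → Fin (a + b) → ℕ
  wordPattern-at m a b σ σ-injective (no misses) = wordPattern m a b (lower σ misses) (lower-injective σ misses σ-injective)
    where open MissesRowZero
  wordPattern-at m (suc a) b σ σ-injective (yes (i₀ , e)) = insertAt (wordPattern m a b others others-injective) i₀ 0
    where open HitsRowZeroAt σ σ-injective i₀ e
  wordPattern-at m zero (suc b) σ σ-injective (yes (i₀ , e)) = insertAt (wordPattern m zero b others others-injective) i₀ 1
    where open HitsRowZeroAt σ σ-injective i₀ e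
  wordPattern-at m zero zero σ σ-injective (yes (() , _))

mutual
  wordPattern-binary : ∀ m a b (σ : Fin (a + b) → Fin m) (σ-injective : Injective _≡_ _≡_ σ) → Binary (wordPattern m a b σ σ-injective)
  wordPattern-binary zero a b σ _ j with σ j
  ... | ()
  wordPattern-binary (suc m) a b σ σ-injective = wordPattern-at-binary m a b σ σ-injective (hitsRowZero? σ)

  wordPattern-at-binary : ∀ m a b (σ : Fin (a + b) → Fin (suc m)) (σ-injective : Injective _≡_ _≡_ σ) d
                    → Binary (wordPattern-at m a b σ σ-injective d)
  wordPattern-at-binary m a b σ σ-injective (no misses) = wordPattern-binary m a b (lower σ misses) (lower-injective σ misses σ-injective)
    where open MissesRowZero
  wordPattern-at-binary m (suc a) b σ σ-injective (yes (i₀ , e)) = insertAt-binary _ i₀ 0 z≤n (wordPattern-binary m a b _ _)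
  wordPattern-at-binary m zero (suc b) σ σ-injective (yes (i₀ , e)) = insertAt-binary _ i₀ 1 ≤-refl (wordPattern-binary m zero b _ _)
  wordPattern-at-binary m zero zero σ σ-injective (yes (() , _))

mutual
  wordPattern-ones : ∀ m a b (σ : Fin (a + b) → Fin m) (σ-injective : Injective _≡_ _≡_ σ) → onesOf (wordPattern m a b σ σ-injective) ≡ b
  wordPattern-ones zero zero zero σ σ-injective = refl
  wordPattern-ones zero zero (suc b) σ σ-injective with σ zero
  ... | ()
  wordPattern-ones zero (suc a) b σ σ-injective with σ zero
  ... | ()
  wordPattern-ones (suc m) a b σ σ-injective = wordPattern-at-ones m a b σ σ-injective (hitsRowZero? σ)

  wordPattern-at-ones : ∀ m a b (σ : Fin (a + b) → Fin (suc m)) (σ-injective : Injective _≡_ _≡_ σ) d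
                  → onesOf (wordPattern-at m a b σ σ-injective d) ≡ b
  wordPattern-at-ones m a b σ σ-injective (no misses) = wordPattern-ones m a b (lower σ misses) (lower-injective σ misses σ-injective)
    where open MissesRowZero
  wordPattern-at-ones m (suc a) b σ σ-injective (yes (i₀ , e)) =
    trans (onesOf-insertAt _ i₀ 0) (wordPattern-ones m a b _ _)
  wordPattern-at-ones m zero (suc b) σ σ-injective (yes (i₀ , e)) =
    trans (onesOf-insertAt _ i₀ 1) (cong suc (wordPattern-ones m zero b _ _))
  wordPattern-at-ones m zero zero σ σ-injective (yes (() , _))

module WordPatterns (r″ : ℕ) where
  open Alphabet r″
  open ColumnWords r″

  carriersShowing : ∀ m a b q → (Fin (a + b) → Fin m) → (Fin (a + b) → ℕ) → ℕ
  carriersShowing m a b q σ β = total m (λ x → when (CarriesWord? x a b q) (when (Matches? σ β x) 1))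

  short-carriers-miss : ∀ m a b q {k} (σ : Fin k → Fin m) → Injective _≡_ _≡_ σ → ∀ β → Binary β → a + b < k
                      → ∀ x → when (CarriesWord? x a b q) (when (Matches? σ β x) 1) ≡ 0
  short-carriers-miss m a b q σ σ-injective β β-binary a+b<k x with CarriesWord? x a b q
  ... | no _ = refl
  ... | yes c with Matches? σ β x
  ...   | no _ = refl
  ...   | yes h = ⊥-elim (<⇒≱ a+b<k (subst (_ ≤_) (carrier-binaryCount x a b q c)
                    (showing⇒binaryCount σ σ-injective x (λ j → subst (_≤ 1) (sym (h j)) (β-binary j)))))

  CarrierBound : ℕ → Set
  CarrierBound m = ∀ a b q (σ : Fin (a + b) → Fin m) → Injective _≡_ _≡_ σ → ∀ β → Binary β
                 → carriersShowing m a b q σ β ≤ q ⊓ r″ ^ (m ∸ (a + b))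

  -- A carrier whose first entry is a letter of the word has too few
  -- (0,1)-entries below to show a wordPattern on a + b of those rows.
  binary-first-misses : ∀ m a b q v → v ≤ 1 → (σ : Fin (a + b) → Fin m) → Injective _≡_ _≡_ σ → ∀ β → Binary β
                      → ∀ x → when (CarriesWord? (v ∷ x) a b q) (when (Matches? σ β x) 1) ≡ 0
  binary-first-misses m zero zero q zero _ σ σ-injective β β-binary x = refl
  binary-first-misses m zero zero q (suc zero) _ σ σ-injective β β-binary x = refl
  binary-first-misses m (suc a) b q zero _ σ σ-injective β β-binary x = short-carriers-miss m a b q σ σ-injective β β-binary ≤-refl x
  binary-first-misses m (suc a) b q (suc zero) _ σ σ-injective β β-binary x = refl
  binary-first-misses m zero (suc b) q zero _ σ σ-injective β β-binary x = refl
  binary-first-misses m zero (suc b) q (suc zero) _ σ σ-injective β β-binary x = short-carriers-miss m zero b q σ σ-injective β β-binary ≤-refl x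
  binary-first-misses m a b q (suc (suc v)) (s≤s ())

  -- If σ misses row 0, a carrier showing β starts with a filler digit 2+w
  -- (by binary-first-misses), and the fill index of the rest is below q ∸ w·R.
  carriers-missing-row-zero : ∀ m → CarrierBound m → ∀ a b q (σ : Fin (a + b) → Fin (suc m)) (misses : ¬ HitsRowZero σ)
    → Injective _≡_ _≡_ σ → ∀ β → Binary β → carriersShowing (suc m) a b q σ β ≤ q ⊓ r″ ^ (suc m ∸ (a + b))
  carriers-missing-row-zero m bound a b q σ misses σ-injective β β-binary = begin
      ∑< r (λ v → total m (λ x → when (CarriesWord? (v ∷ x) a b q) (when (Matches? σ β (v ∷ x)) 1)))
    ≤⟨ ∑-mono r (λ v → total-mono m (λ x → when-mono (CarriesWord? (toℕ v ∷ x) a b q) (CarriesWord? (toℕ v ∷ x) a b q) id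
                     (when-mono (Matches? σ β (toℕ v ∷ x)) (Matches? σ′ β x) {1} lower-matches ≤-refl))) ⟩
      h 0 + (h 1 + ∑< r″ (λ w → h (suc (suc w))))
    ≡⟨ cong₂ (λ u v → u + (v + ∑< r″ (λ w → h (suc (suc w))))) (binary-first 0 z≤n) (binary-first 1 ≤-refl) ⟩
      ∑< r″ (λ w → carriersShowing m a b (q ∸ w * R) σ′ β)
    ≤⟨ ∑-mono r″ (λ w → bound a b (q ∸ toℕ w * R) σ′ (lower-injective σ-injective) β β-binary) ⟩
      ∑< r″ (λ w → (q ∸ w * R) ⊓ R)
    ≡⟨ ∑<-blocks r″ q R ⟩
      q ⊓ (r″ * R)
    ≡⟨ cong (λ z → q ⊓ r″ ^ z) (sym (+-∸-assoc 1 (injective⇒≤ (lower-injective σ-injective)))) ⟩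
      q ⊓ r″ ^ (suc m ∸ (a + b)) ∎
    where
    open ≤-Reasoning
    open MissesRowZero σ misses
    σ′ = lower
    R = r″ ^ (m ∸ (a + b))
    h : ℕ → ℕ
    h v = total m (λ x → when (CarriesWord? (v ∷ x) a b q) (when (Matches? σ′ β x) 1))
    binary-first : ∀ v → v ≤ 1 → h v ≡ 0
    binary-first v v≤1 = total-zero m (binary-first-misses m a b q v v≤1 σ′ (lower-injective σ-injective) β β-binary)

  count-through-row-zero : ∀ {m k ℓ} {P : Vec ℕ (suc m) → Set ℓ} (P? : ∀ x → Dec (P x))
    (σ : Fin (suc k) → Fin (suc m)) (σ-injective : Injective _≡_ _≡_ σ) β → Binary β → (i₀ : Fin (suc k)) (e : σ i₀ ≡ zero)
    → ∀ {T} → (∀ v → v ≤ 1 → total m (λ x → when (P? (v ∷ x)) (when (Matches? (HitsRowZeroAt.others σ σ-injective i₀ e) (β ∘ punchIn i₀) x) 1)) ≤ T)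
    → total (suc m) (λ x → when (P? x) (when (Matches? σ β x) 1)) ≤ T
  count-through-row-zero {m} P? σ σ-injective β β-binary i₀ e {T} bound-at = begin
      ∑< r f
    ≡⟨ ∑<-single r f (β i₀) (s≤s (≤-trans (β-binary i₀) (s≤s z≤n)))
                 (λ u u≢β → total-zero m (λ x → vanish (P? (u ∷ x)) (Matches? σ β (u ∷ x)) (u≢β ∘ head-matches))) ⟩
      f (β i₀)
    ≤⟨ total-mono m (λ x → when-mono (P? (β i₀ ∷ x)) (P? (β i₀ ∷ x)) id
                     (when-mono (Matches? σ β (β i₀ ∷ x)) (Matches? others (β ∘ punchIn i₀) x) others-match ≤-refl)) ⟩
      total m (λ x → when (P? (β i₀ ∷ x)) (when (Matches? others (β ∘ punchIn i₀) x) 1))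
    ≤⟨ bound-at (β i₀) (β-binary i₀) ⟩
      T ∎
    where
    open ≤-Reasoning
    open HitsRowZeroAt σ σ-injective i₀ e
    f : ℕ → ℕ
    f v = total m (λ x → when (P? (v ∷ x)) (when (Matches? σ β (v ∷ x)) 1))
    vanish : ∀ {a b} {A : Set a} {B : Set b} (d : Dec A) (e : Dec B) → ¬ B → when d (when e 1) ≡ 0
    vanish (yes _) e ¬b = when-no e 1 ¬b
    vanish (no _) e ¬b = refl

  -- If σ selects row 0 at i₀, only columns starting with β i₀ can show β; for
  -- a carrier that entry is the first letter of the word.
  carriers-hitting-row-zero : ∀ m → CarrierBound m → ∀ a b q (σ : Fin (a + b) → Fin (suc m)) (σ-injective : Injective _≡_ _≡_ σ)
    → ∀ β → Binary β → (i₀ : Fin (a + b)) → σ i₀ ≡ zero → carriersShowing (suc m) a b q σ β ≤ q ⊓ r″ ^ (suc m ∸ (a + b))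
  carriers-hitting-row-zero m bound zero zero q σ σ-injective β β-binary () e
  carriers-hitting-row-zero m bound (suc a) b q σ σ-injective β β-binary i₀ e =
    count-through-row-zero (λ x → CarriesWord? x (suc a) b q) σ σ-injective β β-binary i₀ e first-letter
    where
    open HitsRowZeroAt σ σ-injective i₀ e
    first-letter : ∀ v → v ≤ 1 → total m (λ x → when (CarriesWord? (v ∷ x) (suc a) b q) (when (Matches? others (β ∘ punchIn i₀) x) 1))
                               ≤ q ⊓ r″ ^ (m ∸ (a + b))
    first-letter zero _ = bound a b q others others-injective (β ∘ punchIn i₀) (β-binary ∘ punchIn i₀)
    first-letter (suc zero) _ = ≤-trans (≤-reflexive (total-zero m (λ _ → refl))) z≤n
    first-letter (suc (suc v)) (s≤s ())
  carriers-hitting-row-zero m bound zero (suc b) q σ σ-injective β β-binary i₀ e =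
    count-through-row-zero (λ x → CarriesWord? x zero (suc b) q) σ σ-injective β β-binary i₀ e first-letter
    where
    open HitsRowZeroAt σ σ-injective i₀ e
    first-letter : ∀ v → v ≤ 1 → total m (λ x → when (CarriesWord? (v ∷ x) zero (suc b) q) (when (Matches? others (β ∘ punchIn i₀) x) 1))
                               ≤ q ⊓ r″ ^ (m ∸ b)
    first-letter zero _ = ≤-trans (≤-reflexive (total-zero m (λ _ → refl))) z≤n
    first-letter (suc zero) _ = bound zero b q others others-injective (β ∘ punchIn i₀) (β-binary ∘ punchIn i₀)
    first-letter (suc (suc v)) (s≤s ())

  -- At most min(q, (r-2)^{m-a-b}) carriers show a given (0,1)-pattern on a + b
  -- distinct rows: they must carry the word exactly on those rows.
  carriersShowing-≤ : ∀ m → CarrierBound m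
  carriersShowing-≤ zero zero zero zero σ _ β _ = z≤n
  carriersShowing-≤ zero zero zero (suc q) σ _ β _ =
    ≤-trans (when-≤ (CarriesWord? [] 0 0 (suc q)) _) (≤-trans (when-≤ (Matches? σ β []) 1) (≤-reflexive (cong suc (sym (⊓-zeroʳ q)))))
  carriersShowing-≤ zero zero (suc b) q σ _ _ _ with σ zero
  ... | ()
  carriersShowing-≤ zero (suc a) b q σ _ _ _ with σ zero
  ... | ()
  carriersShowing-≤ (suc m) a b q σ σ-injective β β-binary with hitsRowZero? σ
  ... | no misses = carriers-missing-row-zero m (carriersShowing-≤ m) a b q σ misses σ-injective β β-binary
  ... | yes (i₀ , e) = carriers-hitting-row-zero m (carriersShowing-≤ m) a b q σ σ-injective β β-binary i₀ e

  mutual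
    avoiders-miss-pattern : ∀ m (x : Vec ℕ m) a b (σ : Fin (a + b) → Fin m) (σ-injective : Injective _≡_ _≡_ σ)
                          → AvoidsWord x a b → ¬ Matches σ (wordPattern m a b σ σ-injective) x
    avoiders-miss-pattern zero [] zero zero σ σ-injective () h
    avoiders-miss-pattern zero [] zero (suc b) σ σ-injective _ _ with σ zero
    ... | ()
    avoiders-miss-pattern zero [] (suc a) b σ σ-injective _ _ with σ zero
    ... | ()
    avoiders-miss-pattern (suc m) (v ∷ x) a b σ σ-injective =
      avoiders-miss-pattern-at m v x a b σ σ-injective (hitsRowZero? σ)

    avoiders-miss-pattern-at : ∀ m v (x : Vec ℕ m) a b (σ : Fin (a + b) → Fin (suc m)) (σ-injective : Injective _≡_ _≡_ σ) d
                             → AvoidsWord (v ∷ x) a b → ¬ Matches σ (wordPattern-at m a b σ σ-injective d) (v ∷ x)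
    avoiders-miss-pattern-at m v x a b σ σ-injective (no misses) avoids h =
      avoiders-miss-pattern m x a b lower (lower-injective σ-injective) (avoids-tail v x a b avoids) (lower-matches h)
      where open MissesRowZero σ misses
    avoiders-miss-pattern-at m v x (suc a) b σ σ-injective (yes (i₀ , e)) avoids h =
      avoiders-miss-pattern m x a b others others-injective (subst (λ z → AvoidsWord (z ∷ x) (suc a) b) v≡0 avoids)
        (λ j → trans (others-match h j) (insertAt-punchIn _ i₀ 0 j))
      where
      open HitsRowZeroAt σ σ-injective i₀ e
      v≡0 : v ≡ 0
      v≡0 = trans (head-matches h) (insertAt-lookup _ i₀ 0)
    avoiders-miss-pattern-at m v x zero (suc b) σ σ-injective (yes (i₀ , e)) avoids h =
      avoiders-miss-pattern m x zero b others others-injective (subst (λ z → AvoidsWord (z ∷ x) zero (suc b)) v≡1 avoids)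
        (λ j → trans (others-match h j) (insertAt-punchIn _ i₀ 1 j))
      where
      open HitsRowZeroAt σ σ-injective i₀ e
      v≡1 : v ≡ 1
      v≡1 = trans (head-matches h) (insertAt-lookup _ i₀ 1)
    avoiders-miss-pattern-at m v x zero zero σ σ-injective (yes (() , _))

≺-refl : ∀ {k l} (F : Mat k l) → F ≺ F
≺-refl F = id , id , id , id , λ i j → refl

≺-trans : ∀ {k l m n o p} {H : Mat k l} {F : Mat m n} {A : Mat o p} → H ≺ F → F ≺ A → H ≺ A
≺-trans (σ , τ , σ-inj , τ-inj , e) (σ′ , τ′ , σ′-inj , τ′-inj , e′) =
  σ′ ∘ σ , τ′ ∘ τ , σ-inj ∘ σ′-inj , τ-inj ∘ τ′-inj , λ i j → trans (e′ (σ i) (τ j)) (e i j)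

simple⇒1-simple : ∀ {k l} (F : Mat k l) → Simple F → PSimple 1 F
simple⇒1-simple {k} {l} F F-simple j = subst (_≤ 1) (sym (length-filter-tabulate (ColEq? F j) l id))
  (∑-≤1 l _ (λ a → when-≤ (ColEq? F j a) 1)
    (λ a a′ pa pa′ → trans (sym (F-simple j a (when-pos (ColEq? F j a) 1 pa))) (F-simple j a′ (when-pos (ColEq? F j a′) 1 pa′))))

countₗ : ∀ {k} → Vec ℕ k → List (Vec ℕ k) → ℕ
countₗ x Ls = ∑ₗ (λ y → when (y ≟v x) 1) Ls

distinct⇒simple : ∀ {k} (Ls : List (Vec ℕ k)) → (∀ j → countₗ (L.lookup Ls j) Ls ≤ 1) → Simple (fromCols Ls)
distinct⇒simple Ls distinct j j′ same =
  ∑≤1-unique (length Ls) (λ c → when (L.lookup Ls c ≟v x) 1) (subst (_≤ 1) (sym (∑-lookup _ Ls)) (distinct j))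
    j j′ (≤-reflexive (sym (when-yes (x ≟v x) 1 refl)))
    (≤-reflexive (sym (when-yes (L.lookup Ls j′ ≟v x) 1 (sym (lookup-extensional _ _ same)))))
  where x = L.lookup Ls j

copiesOf : ∀ {k} → (Fin k → ℕ) → List (Vec ℕ k) → ℕ
copiesOf β Ls = ∑ₗ (λ v → when (Matches? id β v) 1) Ls

module ZeroOneColumns where

  ZeroOne : ∀ {k} → Vec ℕ k → Set
  ZeroOne v = ∀ i → lookup v i < 2

  allCols-zeroOne : ∀ k → All ZeroOne (allCols k)
  allCols-zeroOne zero = (λ ()) ∷ []
  allCols-zeroOne (suc k) = Allₚ.++⁺ (Allₚ.gmap⁺ (prepend 0 (s≤s z≤n)) (allCols-zeroOne k))
                                     (Allₚ.gmap⁺ (prepend 1 ≤-refl) (allCols-zeroOne k))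
    where
    prepend : ∀ c → c < 2 → ∀ {v : Vec ℕ k} → ZeroOne v → ZeroOne (c ∷ v)
    prepend c c<2 v-01 zero = c<2
    prepend c c<2 v-01 (suc i) = v-01 i

  K-binary : ∀ k → IsRMatrix 2 (K k)
  K-binary k i j = All.lookup (allCols-zeroOne k) (∈-lookup j) i

  Ks-binary : ∀ k s → IsRMatrix 2 (Ks k s)
  Ks-binary k s i j = All.lookup (Allₚ.filter⁺ (λ v → ones v ≟ s) (allCols-zeroOne k)) (∈-lookup j) i

  allCols-distinct : ∀ k (x : Vec ℕ k) → countₗ x (allCols k) ≤ 1
  allCols-distinct zero [] = ≤-refl
  allCols-distinct (suc k) (u ∷ x) = begin
      ∑ₗ h (map (0 ∷_) (allCols k) ++ map (1 ∷_) (allCols k))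
    ≡⟨ ∑ₗ-++ h (map (0 ∷_) (allCols k)) _ ⟩
      ∑ₗ h (map (0 ∷_) (allCols k)) + ∑ₗ h (map (1 ∷_) (allCols k))
    ≡⟨ cong₂ _+_ (first-entry 0) (first-entry 1) ⟩
      when (0 ≟ u) (countₗ x (allCols k)) + when (1 ≟ u) (countₗ x (allCols k))
    ≤⟨ +-mono-≤ (when-mono (0 ≟ u) (0 ≟ u) id (allCols-distinct k x)) (when-mono (1 ≟ u) (1 ≟ u) id (allCols-distinct k x)) ⟩
      when (0 ≟ u) 1 + when (1 ≟ u) 1
    ≤⟨ at-most-one-head u ⟩
      1 ∎
    where
    open ≤-Reasoning
    h = λ (y : Vec ℕ (suc k)) → when (y ≟v (u ∷ x)) 1
    first-entry : ∀ c → ∑ₗ h (map (c ∷_) (allCols k)) ≡ when (c ≟ u) (countₗ x (allCols k))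
    first-entry c = trans (∑ₗ-map h (c ∷_) (allCols k))
      (trans (∑ₗ-cong (allCols k) (λ y → when-× ((c ∷ y) ≟v (u ∷ x)) (c ≟ u) (y ≟v x) ∷-injective (cong₂ _∷_)))
             (∑ₗ-when (c ≟ u) _ (allCols k)))
      where open import Data.Vec.Properties using (∷-injective)
    at-most-one-head : ∀ u → when (0 ≟ u) 1 + when (1 ≟ u) 1 ≤ 1
    at-most-one-head zero = ≤-refl
    at-most-one-head (suc zero) = ≤-refl
    at-most-one-head (suc (suc u)) = z≤n

  colsWith-distinct : ∀ k s (x : Vec ℕ k) → countₗ x (colsWith k s) ≤ 1
  colsWith-distinct k s x = ≤-trans (≤-reflexive (∑ₗ-filter (λ v → ones v ≟ s) _ (allCols k)))
    (≤-trans (∑ₗ-mono (allCols k) (λ y → when-≤ (ones y ≟ s) _)) (allCols-distinct k x))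

  allCols-complete : ∀ k (β : Fin k → ℕ) → Binary β → 1 ≤ copiesOf β (allCols k)
  allCols-complete zero β β-binary = ≤-reflexive (cong (_+ 0) (sym (when-yes (Matches? id β []) 1 (λ ()))))
  allCols-complete (suc k) β β-binary =
    subst (1 ≤_) (sym (trans (∑ₗ-++ _ (map (0 ∷_) (allCols k)) _) (cong₂ _+_ (∑ₗ-map _ (0 ∷_) (allCols k)) (∑ₗ-map _ (1 ∷_) (allCols k)))))
      (with-head (β zero) refl (β-binary zero))
    where
    tail-copies : ∀ c → c ≡ β zero → copiesOf (β ∘ suc) (allCols k) ≤ ∑ₗ (λ v → when (Matches? id β (c ∷ v)) 1) (allCols k)
    tail-copies c e = ∑ₗ-mono (allCols k) (λ v → when-mono (Matches? id (β ∘ suc) v) (Matches? id β (c ∷ v))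
                         (λ { h zero → e ; h (suc i) → h i }) ≤-refl)
    with-head : ∀ c → c ≡ β zero → c ≤ 1 → 1 ≤ ∑ₗ (λ v → when (Matches? id β (0 ∷ v)) 1) (allCols k)
                                            + ∑ₗ (λ v → when (Matches? id β (1 ∷ v)) 1) (allCols k)
    with-head zero e _ = ≤-trans (≤-trans (allCols-complete k (β ∘ suc) (β-binary ∘ suc)) (tail-copies 0 e)) (m≤m+n _ _)
    with-head (suc zero) e _ = ≤-trans (≤-trans (allCols-complete k (β ∘ suc) (β-binary ∘ suc)) (tail-copies 1 e)) (m≤n+m _ _)
    with-head (suc (suc c)) e (s≤s ())

  colsWith-complete : ∀ k s (β : Fin k → ℕ) → Binary β → onesOf β ≡ s → 1 ≤ copiesOf β (colsWith k s)
  colsWith-complete k s β β-binary β-ones = ≤-trans (allCols-complete k β β-binary)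
    (≤-trans (∑ₗ-mono (allCols k) kept) (≤-reflexive (sym (∑ₗ-filter (λ v → ones v ≟ s) _ (allCols k)))))
    where
    sum-tabulate : ∀ k (β : Fin k → ℕ) → Binary β → ones (tabulate β) ≡ onesOf β
    sum-tabulate zero β _ = refl
    sum-tabulate (suc k) β β-binary = cong₂ _+_ (one? (β zero) (β-binary zero)) (sum-tabulate k (β ∘ suc) (β-binary ∘ suc))
      where
      one? : ∀ c → c ≤ 1 → c ≡ when (c ≟ 1) 1
      one? zero _ = refl
      one? (suc zero) _ = refl
      one? (suc (suc c)) (s≤s ())
    kept : ∀ v → when (Matches? id β v) 1 ≤ when (ones v ≟ s) (when (Matches? id β v) 1)
    kept v with Matches? id β v
    ... | no _ = z≤n
    ... | yes v≡β = ≤-reflexive (sym (when-yes (ones v ≟ s) 1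
            (trans (cong ones (lookup-extensional v (tabulate β) (λ i → trans (v≡β i) (sym (lookup∘tabulate β i)))))
                   (trans (sum-tabulate k β β-binary) β-ones))))

module LowerBound (r″ p : ℕ) where
  open Alphabet r″
  open ColumnWords r″
  open WordPatterns r″

  allColumns : ∀ m → List (Vec ℕ m)
  allColumns zero = [] ∷ []
  allColumns (suc m) = L.concatMap (λ v → map (v ∷_) (allColumns m)) (upTo r)

  allColumns-inRange : ∀ m → All InRange (allColumns m)
  allColumns-inRange zero = (λ ()) ∷ []
  allColumns-inRange (suc m) = Allₚ.concat⁺ (Allₚ.map⁺ (Allₚ.applyUpTo⁺₁ id r (λ v<r → Allₚ.gmap⁺ (prepend v<r) (allColumns-inRange m))))
    where
    prepend : ∀ {v} → v < r → ∀ {x : Vec ℕ m} → InRange x → InRange (v ∷ x)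
    prepend v<r x-range zero = v<r
    prepend v<r x-range (suc i) = x-range i

  ∑ₗ-allColumns : ∀ m h → ∑ₗ h (allColumns m) ≡ total m h
  ∑ₗ-allColumns zero h = +-identityʳ (h [])
  ∑ₗ-allColumns (suc m) h = begin
      ∑ₗ h (L.concatMap f (upTo r))
    ≡⟨ ∑ₗ-concat h (map f (upTo r)) ⟩
      ∑ₗ (∑ₗ h) (map f (upTo r))
    ≡⟨ ∑ₗ-map (∑ₗ h) f (upTo r) ⟩
      ∑ₗ (∑ₗ h ∘ f) (upTo r)
    ≡⟨ ∑ₗ-applyUpTo (∑ₗ h ∘ f) id r ⟩
      ∑< r (∑ₗ h ∘ f)
    ≡⟨ ∑-cong r (λ v → trans (∑ₗ-map h (toℕ v ∷_) (allColumns m)) (∑ₗ-allColumns m (λ x → h (toℕ v ∷ x)))) ⟩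
      total (suc m) h ∎
    where
    open ≡-Reasoning
    f = λ v → map (v ∷_) (allColumns m)

  -- With a = k - s and b = s: the columns avoiding 0^a 1^b, together with the
  -- carriers of 0^a 1^b with fill index below p-1.
  module Construction (a b m : ℕ) where

    Kept : Vec ℕ m → Set
    Kept y = AvoidsWord y a b ⊎ CarriesWord y a b (p ∸ 1)

    Kept? : ∀ y → Dec (Kept y)
    Kept? y = AvoidsWord? y a b ⊎-dec CarriesWord? y a b (p ∸ 1)

    kept : List (Vec ℕ m)
    kept = filter Kept? (allColumns m)

    A : Mat m (length kept)
    A = fromCols kept

    kept-inRange : All InRange kept
    kept-inRange = Allₚ.filter⁺ Kept? (allColumns-inRange m)

    A-range : IsRMatrix r A
    A-range i j = All.lookup kept-inRange (∈-lookup j) i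

    A-simple : Simple A
    A-simple = distinct⇒simple kept λ j → let x = L.lookup kept j in begin
        countₗ x kept
      ≡⟨ ∑ₗ-filter Kept? _ (allColumns m) ⟩
        ∑ₗ (λ y → when (Kept? y) (when (y ≟v x) 1)) (allColumns m)
      ≤⟨ ∑ₗ-mono (allColumns m) (λ y → when-≤ (Kept? y) _) ⟩
        countₗ x (allColumns m)
      ≡⟨ ∑ₗ-allColumns m _ ⟩
        total m (λ y → when (y ≟v x) 1)
      ≡⟨ total-cong m (λ y → when-cong (y ≟v x) (x ≟v y) 1 sym sym) ⟩
        total m (λ y → when (x ≟v y) 1)
      ≡⟨ total-point m x (All.lookup kept-inRange (∈-lookup j)) (λ _ → 1) ⟩
        1 ∎
      where open ≤-Reasoning

    A-size : (a + b ≤ m → p ∸ 1 ≤ r″ ^ (m ∸ (a + b))) → length kept ≡ G m (a + b) + (p ∸ 1) * (m C (a + b))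
    A-size room = begin
        length kept
      ≡⟨ trans (∑ₗ-length kept) (∑ₗ-filter Kept? _ (allColumns m)) ⟩
        ∑ₗ (λ y → when (Kept? y) 1) (allColumns m)
      ≡⟨ ∑ₗ-allColumns m _ ⟩
        total m (λ y → when (Kept? y) 1)
      ≡⟨ total-cong m avoiders+carriers ⟩
        total m (λ y → when (AvoidsWord? y a b) 1 + when (CarriesWord? y a b (p ∸ 1)) 1)
      ≡⟨ total-+ m _ _ ⟩
        total m (λ y → when (AvoidsWord? y a b) 1) + carriers m a b (p ∸ 1)
      ≡⟨ cong₂ _+_ (count-avoiders m a b) (trans (count-carriers m a b (p ∸ 1)) enough-fillings) ⟩
        G m (a + b) + (p ∸ 1) * (m C (a + b)) ∎
      where
      open ≡-Reasoning
      avoiders+carriers : ∀ y → when (Kept? y) 1 ≡ when (AvoidsWord? y a b) 1 + when (CarriesWord? y a b (p ∸ 1)) 1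
      avoiders+carriers y with AvoidsWord? y a b | CarriesWord? y a b (p ∸ 1)
      ... | yes avoids | yes carries = ⊥-elim (carries⇒¬avoids y a b (p ∸ 1) carries avoids)
      ... | yes _ | no _ = refl
      ... | no _ | yes _ = refl
      ... | no _ | no _ = refl
      -- each position set has room for p - 1 fillings (or there are none)
      enough-fillings : (m C (a + b)) * ((p ∸ 1) ⊓ r″ ^ (m ∸ (a + b))) ≡ (p ∸ 1) * (m C (a + b))
      enough-fillings with a + b ≤? m
      ... | yes a+b≤m = trans (cong ((m C (a + b)) *_) (m≤n⇒m⊓n≡m (room a+b≤m))) (*-comm (m C (a + b)) (p ∸ 1))
      ... | no a+b≰m rewrite k>n⇒nCk≡0 {m} {a + b} (≰⇒> a+b≰m) = sym (*-zeroʳ (p ∸ 1))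

    -- Along any a + b distinct rows, at most p - 1 columns of A show the word
    -- pattern: avoiders never do, carriers at most p - 1 times.
    few-show-pattern : (σ : Fin (a + b) → Fin m) (σ-injective : Injective _≡_ _≡_ σ)
                     → ∑ₗ (λ y → when (Matches? σ (wordPattern m a b σ σ-injective) y) 1) kept ≤ p ∸ 1
    few-show-pattern σ σ-injective = begin
        ∑ₗ (λ y → when (Matches? σ β y) 1) kept
      ≡⟨ ∑ₗ-filter Kept? _ (allColumns m) ⟩
        ∑ₗ (λ y → when (Kept? y) (when (Matches? σ β y) 1)) (allColumns m)
      ≡⟨ ∑ₗ-allColumns m _ ⟩
        total m (λ y → when (Kept? y) (when (Matches? σ β y) 1))
      ≤⟨ total-mono m only-carriers ⟩
        carriersShowing m a b (p ∸ 1) σ β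
      ≤⟨ carriersShowing-≤ m a b (p ∸ 1) σ σ-injective β (wordPattern-binary m a b σ σ-injective) ⟩
        (p ∸ 1) ⊓ r″ ^ (m ∸ (a + b))
      ≤⟨ m⊓n≤m (p ∸ 1) _ ⟩
        p ∸ 1 ∎
      where
      open ≤-Reasoning
      β = wordPattern m a b σ σ-injective
      only-carriers : ∀ y → when (Kept? y) (when (Matches? σ β y) 1) ≤ when (CarriesWord? y a b (p ∸ 1)) (when (Matches? σ β y) 1)
      only-carriers y with Kept? y
      ... | no _ = z≤n
      ... | yes (inj₁ avoids) = ≤-trans (≤-reflexive (when-no (Matches? σ β y) 1 (avoiders-miss-pattern m y a b σ σ-injective avoids))) z≤n
      ... | yes (inj₂ carries) = ≤-reflexive (sym (when-yes (CarriesWord? y a b (p ∸ 1)) _ carries))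

    A-avoids : 1 ≤ p → (Ls : List (Vec ℕ (a + b))) → (∀ β → Binary β → onesOf β ≡ b → p ≤ copiesOf β Ls) → ¬ (fromCols Ls ≺ A)
    A-avoids p≥1 Ls many (σ , τ , σ-injective , τ-injective , agree) = <⇒≱ (p∸1<p p≥1) (begin
        p
      ≤⟨ many β (wordPattern-binary m a b σ σ-injective) (wordPattern-ones m a b σ σ-injective) ⟩
        copiesOf β Ls
      ≡⟨ sym (∑-lookup _ Ls) ⟩
        ∑ (length Ls) (λ j → when (Matches? id β (L.lookup Ls j)) 1)
      ≤⟨ ∑-injection _ _ τ τ-injective _ _ (λ j → when-mono (Matches? id β (L.lookup Ls j)) (Matches? σ β (L.lookup kept (τ j)))
                                                           (λ h i → trans (agree i j) (h i)) ≤-refl) ⟩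
        ∑ (length kept) (λ c → when (Matches? σ β (L.lookup kept c)) 1)
      ≡⟨ ∑-lookup _ kept ⟩
        ∑ₗ (λ y → when (Matches? σ β y) 1) kept
      ≤⟨ few-show-pattern σ σ-injective ⟩
        p ∸ 1 ∎)
      where
      open ≤-Reasoning
      β = wordPattern m a b σ σ-injective
      p∸1<p : 1 ≤ p → p ∸ 1 < p
      p∸1<p (s≤s _) = ≤-refl

forb-exact : ∀ r″ p a b m l (F : Mat (a + b) l) → 1 ≤ p → IsRMatrix 2 F → PSimple p F
  → (a + b ≤ m → p ∸ 1 ≤ r″ ^ (m ∸ (a + b)))
  → (Ls : List (Vec ℕ (a + b))) → fromCols Ls ≺ F → (∀ β → Binary β → onesOf β ≡ b → p ≤ copiesOf β Ls)
  → IsForb m (suc (suc r″)) F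
      (sum (map (λ n → (m C n) * (suc (suc r″) ∸ 1) ^ (m ∸ n)) (upTo (a + b))) + (p ∸ 1) * (m C (a + b)))
forb-exact r″ p a b m l F p≥1 F-binary F-simple room Ls Ls≺F many =
  subst Realized (trans (A-size room) closed-form) (A , A-range , A-simple , λ F≺A → A-avoids p≥1 Ls many (≺-trans {A = A} Ls≺F F≺A)) ,
  λ n B B-range B-simple B-avoids → subst (n ≤_) closed-form (upper-bound F F-binary F-simple B B-range B-simple B-avoids)
  where
  open Alphabet r″ using (G; G-closed-form)
  open UpperBound r″ p using (upper-bound)
  open LowerBound.Construction r″ p a b m
  Realized : ℕ → Set
  Realized N = Σ (Mat m N) λ A → IsRMatrix (suc (suc r″)) A × Simple A × Avoids A F
  closed-form : G m (a + b) + (p ∸ 1) * (m C (a + b)) ≡ _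
  closed-form = cong (_+ (p ∸ 1) * (m C (a + b))) (G-closed-form m (a + b))

-- k = (k - s) + s: the word for K_k^s is 0^{k-s} 1^s.
split-rows : ∀ {s k} → s ≤ k → Σ ℕ λ a → k ≡ a + s
split-rows {s} {k} s≤k = k ∸ s , sym (m∸n+n≡m s≤k)

forb-p-simple : ∀ (r k p m l : ℕ) → 2 ≤ r → 1 ≤ k → 1 ≤ p → 1 ≤ m → (F : Mat k l)
  → IsRMatrix 2 F → PSimple p F
  → (s : ℕ) → s ≤ k → pKs p k s ≺ F
  → (k ≤ m → p ∸ 1 ≤ (r ∸ 2) ^ (m ∸ k))
  → IsForb m r F (sum (map (λ n → (m C n) * (r ∸ 1) ^ (m ∸ n)) (upTo k)) + (p ∸ 1) * (m C k))
forb-p-simple (suc zero) k p m l (s≤s ()) _ _ _ F F-binary F-simple s s≤k pKs≺F room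
forb-p-simple (suc (suc r″)) k p m l _ _ p≥1 _ F F-binary F-simple s s≤k pKs≺F room with split-rows s≤k
... | a , refl = forb-exact r″ p a s m l F p≥1 F-binary F-simple room (concat (replicate p (colsWith (a + s) s))) pKs≺F p-copies
  where
  open ZeroOneColumns
  p-copies : ∀ β → Binary β → onesOf β ≡ s → p ≤ copiesOf β (concat (replicate p (colsWith (a + s) s)))
  p-copies β β-binary β-ones = subst (p ≤_) (sym (∑ₗ-replicate _ p _))
    (≤-trans (≤-reflexive (sym (*-identityʳ p))) (*-monoʳ-≤ p (colsWith-complete (a + s) s β β-binary β-ones)))

-- The second statement: the case p = 1 of forb-exact applies alike to F, K_k^s
-- and K_k, and gives the same value.
forb-simple : ∀ (k l : ℕ) → 1 ≤ k → (F : Mat k l)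
  → IsRMatrix 2 F → Simple F
  → (s : ℕ) → s ≤ k → Ks k s ≺ F
  → ∀ (m r : ℕ) → 2 ≤ r
  → Σ ℕ (λ N → IsForb m r F N × IsForb m r (Ks k s) N × IsForb m r (K k) N)
forb-simple k l _ F F-binary F-simple s s≤k Ks≺F m (suc zero) (s≤s ())
forb-simple k l _ F F-binary F-simple s s≤k Ks≺F m (suc (suc r″)) _ with split-rows s≤k
... | a , refl =
  _ , exact F F-binary (simple⇒1-simple F F-simple) (colsWith (a + s) s) Ks≺F (colsWith-complete (a + s) s)
    , exact (Ks (a + s) s) (Ks-binary (a + s) s) (simple⇒1-simple _ (distinct⇒simple (colsWith (a + s) s) (λ j → colsWith-distinct (a + s) s _)))
            (colsWith (a + s) s) (≺-refl _) (colsWith-complete (a + s) s)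
    , exact (K (a + s)) (K-binary (a + s)) (simple⇒1-simple _ (distinct⇒simple (allCols (a + s)) (λ j → allCols-distinct (a + s) _)))
            (allCols (a + s)) (≺-refl _) (λ β β-binary _ → allCols-complete (a + s) β β-binary)
  where
  open ZeroOneColumns
  exact : ∀ {l} (H : Mat (a + s) l) → IsRMatrix 2 H → PSimple 1 H → (Ls : List (Vec ℕ (a + s))) → fromCols Ls ≺ H
        → (∀ β → Binary β → onesOf β ≡ s → 1 ≤ copiesOf β Ls)
        → IsForb m (suc (suc r″)) H (sum (map (λ n → (m C n) * suc r″ ^ (m ∸ n)) (upTo (a + s))) + 0 * (m C (a + s)))
  exact H H-binary H-simple = forb-exact r″ 1 a s m _ H ≤-refl H-binary H-simple (λ _ → z≤n)

corollary3p4 :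
    (∀ (r k p m l : ℕ) → 2 ≤ r → 1 ≤ k → 1 ≤ p → 1 ≤ m → (F : Mat k l)
      → IsRMatrix 2 F → PSimple p F
      → (s : ℕ) → s ≤ k → pKs p k s ≺ F
      → (k ≤ m → p ∸ 1 ≤ (r ∸ 2) ^ (m ∸ k))
      → IsForb m r F
          (sum (map (λ n → (m C n) * (r ∸ 1) ^ (m ∸ n)) (upTo k)) + (p ∸ 1) * (m C k)))
    ×
    (∀ (k l : ℕ) → 1 ≤ k → (F : Mat k l)
      → IsRMatrix 2 F → Simple F
      → (s : ℕ) → s ≤ k → Ks k s ≺ F
      → ∀ (m r : ℕ) → 2 ≤ r
      → Σ ℕ (λ N → IsForb m r F N × IsForb m r (Ks k s) N × IsForb m r (K k) N))
corollary3p4 = forb-p-simple , forb-simple
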